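{- For every integer $n\ge 2$, \[|\mathrm{SAv}_n(132,3421)|=|\mathrm{SAv}_n(213,4312)|=2n^2-7n+8.\]
   Context: Permutations $\pi\in S_n$ are identified with words $\pi(1)\cdots\pi(n)$. For $\tau\in S_m$, entries $\pi(i_1),\ldots,\pi(i_m)$ with $i_1<\cdots<i_m$ form an occurrence of $\tau$ if for all $j,l$, $\pi(i_j)<\pi(i_l)$ iff $\tau(j)<\tau(l)$; $\pi$ avoids $\tau$ if there is no occurrence. $\mathrm{SAv}_n(\tau_1,\ldots,\tau_r)$ is the set of $\pi\in S_n$ such that both $\pi$ and $\pi^2=\pi\circ\pi$ avoid each of $\tau_1,\ldots,\tau_r$. -}

module Defs where

open import Data.Nat using (ℕ; zero; suc)
open import Data.Fin using (Fin; _<_; #_)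
open import Data.Vec using (Vec; lookup; tabulate; []; _∷_)
open import Data.List using (List; length)
open import Data.List.Membership.Propositional using (_∈_)
open import Data.List.Relation.Unary.Unique.Propositional using (Unique)
open import Data.Product using (Σ; ∃; _×_)
open import Function.Bundles using (_⇔_)
open import Function.Definitions using (Injective)
open import Relation.Binary.PropositionalEquality using (_≡_)
open import Relation.Nullary using (¬_)

-- A permutation π ∈ S_n is represented by its word π(1)⋯π(n),
-- i.e. a vector of length n with entries in Fin n (0-based values),
-- which is injective (hence a bijection of Fin n).
Word : ℕ → Set
Word n = Vec (Fin n) n

IsPerm : ∀ {n} → Word n → Set
IsPerm {n} w = Injective _≡_ _≡_ (lookup w)

square : ∀ {n} → Word n → Word n
square w = tabulate (λ i → lookup w (lookup w i))

StrictlyIncreasing : ∀ {m n} → (Fin m → Fin n) → Set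
StrictlyIncreasing {m} f = ∀ (j l : Fin m) → j < l → f j < f l

Occurrence : ∀ {m n} → Word n → Vec (Fin m) m → (Fin m → Fin n) → Set
Occurrence {m} w τ f =
  StrictlyIncreasing f ×
  (∀ (j l : Fin m) → (lookup w (f j) < lookup w (f l)) ⇔ (lookup τ j < lookup τ l))

Contains : ∀ {m n} → Word n → Vec (Fin m) m → Set
Contains {m} {n} w τ = Σ (Fin m → Fin n) (Occurrence w τ)

Avoids : ∀ {m n} → Word n → Vec (Fin m) m → Set
Avoids w τ = ¬ Contains w τ

InSAv : ∀ {m k n} → Vec (Fin m) m → Vec (Fin k) k → Word n → Set
InSAv τ σ π = IsPerm π × Avoids π τ × Avoids π σ
              × Avoids (square π) τ × Avoids (square π) σ

HasCard : {A : Set} → (A → Set) → ℕ → Set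
HasCard {A} P N = Σ (List A) λ xs → Unique xs × (∀ x → (x ∈ xs) ⇔ P x) × length xs ≡ N

-- patterns, written 1-based in the paper, stored with 0-based entries
p132 : Vec (Fin 3) 3
p132 = # 0 ∷ # 2 ∷ # 1 ∷ []

p3421 : Vec (Fin 4) 4
p3421 = # 2 ∷ # 3 ∷ # 1 ∷ # 0 ∷ []

p213 : Vec (Fin 3) 3
p213 = # 1 ∷ # 0 ∷ # 2 ∷ []

p4312 : Vec (Fin 4) 4
p4312 = # 3 ∷ # 2 ∷ # 0 ∷ # 1 ∷ []

module Submission where

-- Permutations of [0, n) are modelled by functions π : ℕ → ℕ, and 'Good n π' says that
-- π and π ∘ π both avoid 132 and 3421.  The proof is an explicit classification: a
-- permutation in SAv_n(132, 3421) either fixes its last entry, and then is π ⊕ 1 for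
-- some π in SAv_{n−1}(132, 3421), or (for n ≥ 3) it is one of 4n − 9 primitive ones:
-- the n − 1 non-trivial rotations i ↦ i + s mod n, the decreasing permutation, and
-- three families of n − 3 "frames" whose middle part is a reversed prefix.  A datatype
-- of codes names these permutations and 'codes n' lists them.  We prove that every
-- listed code denotes a Good permutation (soundness), that every Good permutation is
-- denoted by a listed code (completeness), and that distinct listed codes denote
-- distinct permutations; so the set has |codes n| elements, and |codes n| =
-- |codes (n−1)| + 4n − 9 gives 2n² − 7n + 8.  Reverse–complement commutes with squaring
-- and exchanges 132 ↔ 213 and 3421 ↔ 4312, which transfers the count to SAv_n(213, 4312).

open import Defs
open import Data.Nat using (ℕ; zero; suc; pred; _+_; _*_; _∸_; _≤_; _<_; z≤n; s≤s; _≟_; _<?_; _≤?_)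
open import Data.Nat.Properties
open import Data.Nat.DivMod using (_%_; m%n<n; %-distribˡ-+; m%n%n≡m%n; m≤n⇒m%n≡m; [m+n]%n≡m%n)
open import Data.Nat.Tactic.RingSolver using (solve-∀)
open import Data.Fin using (Fin; toℕ; fromℕ<; punchOut) renaming (zero to fz; suc to fs; _<_ to _<F_)
import Data.Fin.Properties as FP
open import Data.Vec using (Vec; lookup; tabulate)
open import Data.Vec.Properties using (lookup∘tabulate; tabulate∘lookup; tabulate-cong)
open import Data.List using (List; []; _∷_; _++_; map; length)
open import Data.List.Properties using (length-++; length-map)
open import Data.List.Membership.Propositional using (_∈_)
open import Data.List.Membership.Propositional.Properties using (∈-map⁺; ∈-map⁻; ∈-++⁺ˡ; ∈-++⁺ʳ; ∈-++⁻)
open import Data.List.Relation.Unary.Any using (here; there)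
open import Data.List.Relation.Unary.All as All using (All; []; _∷_)
import Data.List.Relation.Unary.All.Properties as AllP
open import Data.List.Relation.Unary.AllPairs as AP using (AllPairs; []; _∷_)
import Data.List.Relation.Unary.AllPairs.Properties as APP
open import Data.Product using (∃; _×_; _,_; proj₁; proj₂)
open import Data.Sum using (_⊎_; inj₁; inj₂)
open import Data.Empty using (⊥; ⊥-elim)
open import Relation.Nullary using (¬_; Dec; yes; no)
open import Relation.Binary using (tri<; tri≈; tri>)
open import Relation.Binary.PropositionalEquality using (_≡_; _≢_; refl; sym; trans; cong; cong₂; subst; subst₂)
open import Function using (_∘_)
open import Function.Bundles using (mk⇔; Equivalence)



Rng : ℕ → (ℕ → ℕ) → Set
Rng n g = ∀ {i} → i < n → g i < n

Inj : ℕ → (ℕ → ℕ) → Set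
Inj n g = ∀ {i j} → i < n → j < n → g i ≡ g j → i ≡ j

Av132 : ℕ → (ℕ → ℕ) → Set
Av132 n g = ∀ {i j l} → i < j → j < l → l < n → g i < g l → g l < g j → ⊥

Av3421 : ℕ → (ℕ → ℕ) → Set
Av3421 n g = ∀ {i j k l} → i < j → j < k → k < l → l < n → g l < g k → g k < g i → g i < g j → ⊥

Av213 : ℕ → (ℕ → ℕ) → Set
Av213 n g = ∀ {i j l} → i < j → j < l → l < n → g j < g i → g i < g l → ⊥

Av4312 : ℕ → (ℕ → ℕ) → Set
Av4312 n g = ∀ {i j k l} → i < j → j < k → k < l → l < n → g k < g l → g l < g j → g j < g i → ⊥

Av132I : ℕ → ℕ → (ℕ → ℕ) → Set
Av132I a b g = ∀ {i j l} → a ≤ i → i < j → j < l → l < b → g i < g l → g l < g j → ⊥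

Av231I : ℕ → ℕ → (ℕ → ℕ) → Set
Av231I a b g = ∀ {i j l} → a ≤ i → i < j → j < l → l < b → g l < g i → g i < g j → ⊥

sq : (ℕ → ℕ) → ℕ → ℕ
sq g i = g (g i)

Good : ℕ → (ℕ → ℕ) → Set
Good n g = Rng n g × Inj n g × Av132 n g × Av3421 n g × Av132 n (sq g) × Av3421 n (sq g)

Good′ : ℕ → (ℕ → ℕ) → Set
Good′ n g = Rng n g × Inj n g × Av213 n g × Av4312 n g × Av213 n (sq g) × Av4312 n (sq g)

_≈[_]_ : (ℕ → ℕ) → ℕ → (ℕ → ℕ) → Set
f ≈[ n ] g = ∀ {i} → i < n → f i ≡ g i

cong132 : ∀ {n f g} → f ≈[ n ] g → Av132 n f → Av132 n g
cong132 {n} {f} {g} e av {i} {j} {l} ij jl ln x y =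
  av ij jl ln (subst₂ _<_ (sym (e iN)) (sym (e ln)) x) (subst₂ _<_ (sym (e ln)) (sym (e jN)) y)
  where jN = <-trans jl ln
        iN = <-trans ij jN

cong3421 : ∀ {n f g} → f ≈[ n ] g → Av3421 n f → Av3421 n g
cong3421 {n} {f} {g} e av {i} {j} {k} {l} ij jk kl ln x y z =
  av ij jk kl ln (subst₂ _<_ (sym (e ln)) (sym (e kN)) x) (subst₂ _<_ (sym (e kN)) (sym (e iN)) y) (subst₂ _<_ (sym (e iN)) (sym (e jN)) z)
  where kN = <-trans kl ln
        jN = <-trans jk kN
        iN = <-trans ij jN

cong213 : ∀ {n f g} → f ≈[ n ] g → Av213 n f → Av213 n g
cong213 {n} {f} {g} e av {i} {j} {l} ij jl ln x y =
  av ij jl ln (subst₂ _<_ (sym (e jN)) (sym (e iN)) x) (subst₂ _<_ (sym (e iN)) (sym (e ln)) y)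
  where jN = <-trans jl ln
        iN = <-trans ij jN

cong4312 : ∀ {n f g} → f ≈[ n ] g → Av4312 n f → Av4312 n g
cong4312 {n} {f} {g} e av {i} {j} {k} {l} ij jk kl ln x y z =
  av ij jk kl ln (subst₂ _<_ (sym (e kN)) (sym (e ln)) x) (subst₂ _<_ (sym (e ln)) (sym (e jN)) y) (subst₂ _<_ (sym (e jN)) (sym (e iN)) z)
  where kN = <-trans kl ln
        jN = <-trans jk kN
        iN = <-trans ij jN

sqCong : ∀ {n f g} → Rng n f → f ≈[ n ] g → sq f ≈[ n ] sq g
sqCong {n} {f} {g} rg e {i} iN = trans (e (rg iN)) (cong g (e iN))

Good-cong : ∀ {n f g} → Good n f → f ≈[ n ] g → Good n g
Good-cong {n} {f} {g} (rg , ij , a1 , a2 , b1 , b2) e =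
  (λ p → subst (_< n) (e p) (rg p)) ,
  (λ p q eq → ij p q (trans (e p) (trans eq (sym (e q))))) ,
  cong132 e a1 , cong3421 e a2 , cong132 (sqCong rg e) b1 , cong3421 (sqCong rg e) b2

Good′-cong : ∀ {n f g} → Good′ n f → f ≈[ n ] g → Good′ n g
Good′-cong {n} {f} {g} (rg , ij , a1 , a2 , b1 , b2) e =
  (λ p → subst (_< n) (e p) (rg p)) ,
  (λ p q eq → ij p q (trans (e p) (trans eq (sym (e q))))) ,
  cong213 e a1 , cong4312 e a2 , cong213 (sqCong rg e) b1 , cong4312 (sqCong rg e) b2

injective⇒surjective : ∀ {n} (f : Fin n → Fin n) → (∀ {i j} → f i ≡ f j → i ≡ j) → ∀ v → ∃ λ i → f i ≡ v
injective⇒surjective {n} f inj v with FP.any? (λ i → f i FP.≟ v)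
... | yes p = p
injective⇒surjective {suc m} f inj v | no ¬p = ⊥-elim (FP.<-irrefl ij i<j)
  where
    h : Fin (suc m) → Fin m
    h i = punchOut {i = v} {j = f i} (λ eq → ¬p (i , sym eq))
    pg = FP.pigeonhole (n<1+n m) h
    i = proj₁ pg
    j = proj₁ (proj₂ pg)
    i<j = proj₁ (proj₂ (proj₂ pg))
    hij = proj₂ (proj₂ (proj₂ pg))
    ij : i ≡ j
    ij = inj (FP.punchOut-injective {i = v} (λ eq → ¬p (i , sym eq)) (λ eq → ¬p (j , sym eq)) hij)

Surj : ℕ → (ℕ → ℕ) → Set
Surj n g = ∀ {v} → v < n → ∃ λ i → i < n × g i ≡ v

inj⇒surj : ∀ {n g} → Rng n g → Inj n g → Surj n g
inj⇒surj {n} {g} rg ig {v} v<n = toℕ (proj₁ r) , FP.toℕ<n _ ,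
     trans (sym (FP.toℕ-fromℕ< (rg (FP.toℕ<n (proj₁ r))))) (trans (cong toℕ (proj₂ r)) (FP.toℕ-fromℕ< v<n))
  where
    f : Fin n → Fin n
    f i = fromℕ< (rg (FP.toℕ<n i))
    finj : ∀ {i j} → f i ≡ f j → i ≡ j
    finj {i} {j} e = FP.toℕ-injective (ig (FP.toℕ<n i) (FP.toℕ<n j)
       (trans (sym (FP.toℕ-fromℕ< (rg (FP.toℕ<n i)))) (trans (cong toℕ e) (FP.toℕ-fromℕ< (rg (FP.toℕ<n j))))))
    r = injective⇒surjective f finj (fromℕ< v<n)

inj⇒surj₁ : ∀ {γ : ℕ → ℕ} {m : ℕ} → (∀ {i} → 1 ≤ i → i ≤ m → 1 ≤ γ i × γ i ≤ m) →
        (∀ {i j} → 1 ≤ i → i ≤ m → 1 ≤ j → j ≤ m → γ i ≡ γ j → i ≡ j) →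
        ∀ {v} → 1 ≤ v → v ≤ m → ∃ λ p → 1 ≤ p × p ≤ m × γ p ≡ v
inj⇒surj₁ {γ} {m} rg ij {v} 1v vm = suc (proj₁ s) , s≤s z≤n , proj₁ (proj₂ s) , back
  where
    h : ℕ → ℕ
    h i = γ (suc i) ∸ 1
    sp : ∀ {x} → 1 ≤ x → suc (x ∸ 1) ≡ x
    sp (s≤s _) = refl
    hr : Rng m h
    hr {i} i<m = subst (_≤ m) (sym (sp (proj₁ (rg (s≤s z≤n) i<m)))) (proj₂ (rg (s≤s z≤n) i<m))
    hi : Inj m h
    hi {i} {j} i<m j<m e = cong pred (ij (s≤s z≤n) i<m (s≤s z≤n) j<m
            (trans (sym (sp (proj₁ (rg (s≤s z≤n) i<m)))) (trans (cong suc e) (sp (proj₁ (rg (s≤s z≤n) j<m))))))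
    s = inj⇒surj hr hi {v ∸ 1} (subst (_≤ m) (sym (sp 1v)) vm)
    back : γ (suc (proj₁ s)) ≡ v
    back = trans (sym (sp (proj₁ (rg (s≤s z≤n) (proj₁ (proj₂ s)))))) (trans (cong suc (proj₂ (proj₂ s))) (sp 1v))



-- Words versus functions.

asFun : ∀ {n} → Word n → ℕ → ℕ
asFun {n} w i with i <? n
... | yes p = toℕ (lookup w (fromℕ< p))
... | no _ = 0

asFun-fromℕ< : ∀ {n} (w : Word n) {i} (p : i < n) → asFun w i ≡ toℕ (lookup w (fromℕ< p))
asFun-fromℕ< {n} w {i} p with i <? n
... | yes q = refl
... | no ¬q = ⊥-elim (¬q p)

asFun-lookup : ∀ {n} (w : Word n) (a : Fin n) → asFun w (toℕ a) ≡ toℕ (lookup w a)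
asFun-lookup w a = trans (asFun-fromℕ< w (FP.toℕ<n a)) (cong (toℕ ∘ lookup w) (FP.fromℕ<-toℕ a (FP.toℕ<n a)))

-- Values are clamped into Fin n, so that 'asWord' is defined for every g.
clamp : ∀ {n} → Fin n → ℕ → Fin n
clamp {n} i v with v <? n
... | yes p = fromℕ< p
... | no _ = i

clamp-ok : ∀ {n} (i : Fin n) {v} → v < n → toℕ (clamp i v) ≡ v
clamp-ok {n} i {v} p with v <? n
... | yes q = FP.toℕ-fromℕ< q
... | no ¬q = ⊥-elim (¬q p)

asWord : ∀ n → (ℕ → ℕ) → Word n
asWord n g = tabulate (λ i → clamp i (g (toℕ i)))

asFun-asWord : ∀ {n} g → Rng n g → (asFun (asWord n g)) ≈[ n ] g
asFun-asWord {n} g rg {i} p = trans (asFun-fromℕ< (asWord n g) p)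
   (trans (cong toℕ (lookup∘tabulate (λ i → clamp i (g (toℕ i))) (fromℕ< p)))
     (trans (clamp-ok (fromℕ< p) (subst (λ x → g x < n) (sym (FP.toℕ-fromℕ< p)) (rg p))) (cong g (FP.toℕ-fromℕ< p))))

asWord-asFun : ∀ {n} (w : Word n) → asWord n (asFun w) ≡ w
asWord-asFun {n} w = trans (tabulate-cong f) (tabulate∘lookup w)
  where
    f : ∀ i → clamp i (asFun w (toℕ i)) ≡ lookup w i
    f i = FP.toℕ-injective (trans (clamp-ok i (subst (_< n) (sym (asFun-lookup w i)) (FP.toℕ<n (lookup w i)))) (asFun-lookup w i))

asWord-cong : ∀ {n f g} → f ≈[ n ] g → asWord n f ≡ asWord n g
asWord-cong {n} {f} {g} e = tabulate-cong (λ i → cong (clamp i) (e (FP.toℕ<n i)))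

asWord-injective : ∀ {n f g} → Rng n f → Rng n g → asWord n f ≡ asWord n g → f ≈[ n ] g
asWord-injective {n} {f} {g} rf rg e {i} iN =
  trans (sym (asFun-asWord f rf iN)) (trans (cong (λ w → asFun w i) e) (asFun-asWord g rg iN))

asFun-range : ∀ {n} (w : Word n) → Rng n (asFun w)
asFun-range w p = subst (_< _) (sym (asFun-fromℕ< w p)) (FP.toℕ<n _)

asFun-square : ∀ {n} (w : Word n) → asFun (square w) ≈[ n ] sq (asFun w)
asFun-square {n} w {i} p = trans (asFun-fromℕ< (square w) p)
  (trans (cong toℕ (lookup∘tabulate (λ i → lookup w (lookup w i)) (fromℕ< p)))
   (trans (sym (asFun-lookup w (lookup w (fromℕ< p)))) (cong (asFun w) (sym (asFun-fromℕ< w p)))))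

isPerm⇒Inj : ∀ {n} (w : Word n) → IsPerm w → Inj n (asFun w)
isPerm⇒Inj {n} w ip {i} {j} iN jN e = trans (sym (FP.toℕ-fromℕ< iN)) (trans (cong toℕ (ip (FP.toℕ-injective
         (trans (sym (asFun-fromℕ< w iN)) (trans e (asFun-fromℕ< w jN)))))) (FP.toℕ-fromℕ< jN))

Inj⇒isPerm : ∀ {n} (w : Word n) → Inj n (asFun w) → IsPerm w
Inj⇒isPerm {n} w ij {a} {b} e = FP.toℕ-injective (ij (FP.toℕ<n a) (FP.toℕ<n b)
        (trans (asFun-lookup w a) (trans (cong toℕ e) (sym (asFun-lookup w b)))))

module Pat {k : ℕ} (τ : Vec (Fin k) k) (τinj : ∀ a b → toℕ (lookup τ a) ≡ toℕ (lookup τ b) → a ≡ b) where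
  mkOcc : ∀ {n} (w : Word n) (f : Fin k → Fin n) → StrictlyIncreasing f →
          (∀ a b → lookup τ a <F lookup τ b → lookup w (f a) <F lookup w (f b)) → Occurrence w τ f
  mkOcc w f si fwd = si , λ a b → mk⇔ (back a b) (fwd a b)
    where
      back : ∀ a b → lookup w (f a) <F lookup w (f b) → lookup τ a <F lookup τ b
      back a b lt with <-cmp (toℕ (lookup τ a)) (toℕ (lookup τ b))
      ... | tri< x _ _ = x
      ... | tri≈ _ e _ with τinj a b e
      ...   | refl = ⊥-elim (<-irrefl refl lt)
      back a b lt | tri> _ _ x = ⊥-elim (<-asym lt (fwd b a x))

module Positions {n : ℕ} (w : Word n) where
  ga : ∀ {p} (q : p < n) → toℕ (lookup w (fromℕ< q)) ≡ asFun w p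
  ga q = sym (asFun-fromℕ< w q)
  gl : ∀ (a : Fin n) → toℕ (lookup w a) ≡ asFun w (toℕ a)
  gl a = sym (asFun-lookup w a)
  tf : ∀ {p} (q : p < n) → toℕ (fromℕ< q) ≡ p
  tf q = FP.toℕ-fromℕ< q
  lt< : ∀ {p q} (pN : p < n) (qN : q < n) → p < q → fromℕ< pN <F fromℕ< qN
  lt< pN qN lt = subst₂ _<_ (sym (tf pN)) (sym (tf qN)) lt
  vlt : ∀ {p q} (pN : p < n) (qN : q < n) → asFun w p < asFun w q → lookup w (fromℕ< pN) <F lookup w (fromℕ< qN)
  vlt pN qN lt = subst₂ _<_ (sym (ga pN)) (sym (ga qN)) lt
  back : ∀ (a b : Fin n) → lookup w a <F lookup w b → asFun w (toℕ a) < asFun w (toℕ b)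
  back a b lt = subst₂ _<_ (gl a) (gl b) lt

  realise : ∀ {k} {τ : Vec (Fin k) k} {f : Fin k → Fin n} → Occurrence w τ f →
            ∀ a b → suc (toℕ (lookup τ a)) ≡ toℕ (lookup τ b) → asFun w (toℕ (f a)) < asFun w (toℕ (f b))
  realise {f = f} (_ , iff) a b e = back (f a) (f b) (Equivalence.from (iff a b) (≤-reflexive e))

  f3 : ∀ {i j l} → i < n → j < n → l < n → Fin 3 → Fin n
  f3 iN jN lN fz = fromℕ< iN
  f3 iN jN lN (fs fz) = fromℕ< jN
  f3 iN jN lN (fs (fs fz)) = fromℕ< lN

  si3 : ∀ {i j l} (iN : i < n) (jN : j < n) (lN : l < n) → i < j → j < l → StrictlyIncreasing (f3 iN jN lN)
  si3 iN jN lN ij jl fz (fs fz) _ = lt< iN jN ij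
  si3 iN jN lN ij jl fz (fs (fs fz)) _ = lt< iN lN (<-trans ij jl)
  si3 iN jN lN ij jl (fs fz) (fs (fs fz)) _ = lt< jN lN jl
  si3 iN jN lN ij jl fz fz ()
  si3 iN jN lN ij jl (fs fz) fz ()
  si3 iN jN lN ij jl (fs fz) (fs fz) (s≤s ())
  si3 iN jN lN ij jl (fs (fs fz)) fz ()
  si3 iN jN lN ij jl (fs (fs fz)) (fs fz) (s≤s ())
  si3 iN jN lN ij jl (fs (fs fz)) (fs (fs fz)) (s≤s (s≤s ()))

  f4 : ∀ {i j k l} → i < n → j < n → k < n → l < n → Fin 4 → Fin n
  f4 iN jN kN lN fz = fromℕ< iN
  f4 iN jN kN lN (fs fz) = fromℕ< jN
  f4 iN jN kN lN (fs (fs fz)) = fromℕ< kN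
  f4 iN jN kN lN (fs (fs (fs fz))) = fromℕ< lN

  si4 : ∀ {i j k l} (iN : i < n) (jN : j < n) (kN : k < n) (lN : l < n) → i < j → j < k → k < l → StrictlyIncreasing (f4 iN jN kN lN)
  si4 iN jN kN lN ij jk kl fz (fs fz) _ = lt< iN jN ij
  si4 iN jN kN lN ij jk kl fz (fs (fs fz)) _ = lt< iN kN (<-trans ij jk)
  si4 iN jN kN lN ij jk kl fz (fs (fs (fs fz))) _ = lt< iN lN (<-trans ij (<-trans jk kl))
  si4 iN jN kN lN ij jk kl (fs fz) (fs (fs fz)) _ = lt< jN kN jk
  si4 iN jN kN lN ij jk kl (fs fz) (fs (fs (fs fz))) _ = lt< jN lN (<-trans jk kl)
  si4 iN jN kN lN ij jk kl (fs (fs fz)) (fs (fs (fs fz))) _ = lt< kN lN kl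
  si4 iN jN kN lN ij jk kl fz fz ()
  si4 iN jN kN lN ij jk kl (fs fz) fz ()
  si4 iN jN kN lN ij jk kl (fs fz) (fs fz) (s≤s ())
  si4 iN jN kN lN ij jk kl (fs (fs fz)) fz ()
  si4 iN jN kN lN ij jk kl (fs (fs fz)) (fs fz) (s≤s ())
  si4 iN jN kN lN ij jk kl (fs (fs fz)) (fs (fs fz)) (s≤s (s≤s ()))
  si4 iN jN kN lN ij jk kl (fs (fs (fs fz))) fz ()
  si4 iN jN kN lN ij jk kl (fs (fs (fs fz))) (fs fz) (s≤s ())
  si4 iN jN kN lN ij jk kl (fs (fs (fs fz))) (fs (fs fz)) (s≤s (s≤s ()))
  si4 iN jN kN lN ij jk kl (fs (fs (fs fz))) (fs (fs (fs fz))) (s≤s (s≤s (s≤s ())))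

pattern-injective : ∀ {k} (τ τ′ : Vec (Fin k) k) → (∀ a → lookup τ′ (lookup τ a) ≡ a) →
                    ∀ a b → toℕ (lookup τ a) ≡ toℕ (lookup τ b) → a ≡ b
pattern-injective τ τ′ inv a b e = trans (sym (inv a)) (trans (cong (lookup τ′) (FP.toℕ-injective e)) (inv b))

132∘132 : ∀ a → lookup p132 (lookup p132 a) ≡ a
132∘132 fz = refl
132∘132 (fs fz) = refl
132∘132 (fs (fs fz)) = refl

213∘213 : ∀ a → lookup p213 (lookup p213 a) ≡ a
213∘213 fz = refl
213∘213 (fs fz) = refl
213∘213 (fs (fs fz)) = refl

4312∘3421 : ∀ a → lookup p4312 (lookup p3421 a) ≡ a
4312∘3421 fz = refl
4312∘3421 (fs fz) = refl
4312∘3421 (fs (fs fz)) = refl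
4312∘3421 (fs (fs (fs fz))) = refl

3421∘4312 : ∀ a → lookup p3421 (lookup p4312 a) ≡ a
3421∘4312 fz = refl
3421∘4312 (fs fz) = refl
3421∘4312 (fs (fs fz)) = refl
3421∘4312 (fs (fs (fs fz))) = refl

inj132 : ∀ a b → toℕ (lookup p132 a) ≡ toℕ (lookup p132 b) → a ≡ b
inj132 = pattern-injective p132 p132 132∘132

inj213 : ∀ a b → toℕ (lookup p213 a) ≡ toℕ (lookup p213 b) → a ≡ b
inj213 = pattern-injective p213 p213 213∘213

inj3421 : ∀ a b → toℕ (lookup p3421 a) ≡ toℕ (lookup p3421 b) → a ≡ b
inj3421 = pattern-injective p3421 p4312 4312∘3421

inj4312 : ∀ a b → toℕ (lookup p4312 a) ≡ toℕ (lookup p4312 b) → a ≡ b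
inj4312 = pattern-injective p4312 p3421 3421∘4312

module PatternBridge {n : ℕ} (w : Word n) where
  open Positions w
  fwd132 : ∀ {i j l} (iN : i < n) (jN : j < n) (lN : l < n) → asFun w i < asFun w l → asFun w l < asFun w j →
           ∀ a b → lookup p132 a <F lookup p132 b → lookup w (f3 iN jN lN a) <F lookup w (f3 iN jN lN b)
  fwd132 iN jN lN h0 h1 fz fz ()
  fwd132 iN jN lN h0 h1 fz (fs fz) _ = vlt iN jN (<-trans h0 h1)
  fwd132 iN jN lN h0 h1 fz (fs (fs fz)) _ = vlt iN lN h0
  fwd132 iN jN lN h0 h1 (fs fz) fz ()
  fwd132 iN jN lN h0 h1 (fs fz) (fs fz) (s≤s (s≤s ()))
  fwd132 iN jN lN h0 h1 (fs fz) (fs (fs fz)) (s≤s ())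
  fwd132 iN jN lN h0 h1 (fs (fs fz)) fz ()
  fwd132 iN jN lN h0 h1 (fs (fs fz)) (fs fz) _ = vlt lN jN h1
  fwd132 iN jN lN h0 h1 (fs (fs fz)) (fs (fs fz)) (s≤s ())
  from132 : Avoids w p132 → Av132 n (asFun w)
  from132 av {i} {j} {l} ij jl lN h0 h1 =
    av (f3 iN jN lN , Pat.mkOcc p132 inj132 w (f3 iN jN lN) (si3 iN jN lN ij jl) (fwd132 iN jN lN h0 h1))
    where jN = <-trans jl lN
          iN = <-trans ij jN
  to132 : Av132 n (asFun w) → Avoids w p132
  to132 av (f , occ@(si , _)) =
    av (si fz (fs fz) ≤-refl) (si (fs fz) (fs (fs fz)) ≤-refl) (FP.toℕ<n (f (fs (fs fz))))
       (realise {τ = p132} occ fz (fs (fs fz)) refl) (realise {τ = p132} occ (fs (fs fz)) (fs fz) refl)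

  fwd3421 : ∀ {i j k l} (iN : i < n) (jN : j < n) (kN : k < n) (lN : l < n) →
            asFun w l < asFun w k → asFun w k < asFun w i → asFun w i < asFun w j →
            ∀ a b → lookup p3421 a <F lookup p3421 b → lookup w (f4 iN jN kN lN a) <F lookup w (f4 iN jN kN lN b)
  fwd3421 iN jN kN lN h0 h1 h2 fz fz (s≤s (s≤s ()))
  fwd3421 iN jN kN lN h0 h1 h2 fz (fs fz) _ = vlt iN jN h2
  fwd3421 iN jN kN lN h0 h1 h2 fz (fs (fs fz)) (s≤s ())
  fwd3421 iN jN kN lN h0 h1 h2 fz (fs (fs (fs fz))) ()
  fwd3421 iN jN kN lN h0 h1 h2 (fs fz) fz (s≤s (s≤s ()))
  fwd3421 iN jN kN lN h0 h1 h2 (fs fz) (fs fz) (s≤s (s≤s (s≤s ())))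
  fwd3421 iN jN kN lN h0 h1 h2 (fs fz) (fs (fs fz)) (s≤s ())
  fwd3421 iN jN kN lN h0 h1 h2 (fs fz) (fs (fs (fs fz))) ()
  fwd3421 iN jN kN lN h0 h1 h2 (fs (fs fz)) fz _ = vlt kN iN h1
  fwd3421 iN jN kN lN h0 h1 h2 (fs (fs fz)) (fs fz) _ = vlt kN jN (<-trans h1 h2)
  fwd3421 iN jN kN lN h0 h1 h2 (fs (fs fz)) (fs (fs fz)) (s≤s ())
  fwd3421 iN jN kN lN h0 h1 h2 (fs (fs fz)) (fs (fs (fs fz))) ()
  fwd3421 iN jN kN lN h0 h1 h2 (fs (fs (fs fz))) fz _ = vlt lN iN (<-trans h0 h1)
  fwd3421 iN jN kN lN h0 h1 h2 (fs (fs (fs fz))) (fs fz) _ = vlt lN jN (<-trans (<-trans h0 h1) h2)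
  fwd3421 iN jN kN lN h0 h1 h2 (fs (fs (fs fz))) (fs (fs fz)) _ = vlt lN kN h0
  fwd3421 iN jN kN lN h0 h1 h2 (fs (fs (fs fz))) (fs (fs (fs fz))) ()
  from3421 : Avoids w p3421 → Av3421 n (asFun w)
  from3421 av {i} {j} {k} {l} ij jk kl lN h0 h1 h2 =
    av (f4 iN jN kN lN , Pat.mkOcc p3421 inj3421 w (f4 iN jN kN lN) (si4 iN jN kN lN ij jk kl) (fwd3421 iN jN kN lN h0 h1 h2))
    where kN = <-trans kl lN
          jN = <-trans jk kN
          iN = <-trans ij jN
  to3421 : Av3421 n (asFun w) → Avoids w p3421
  to3421 av (f , occ@(si , _)) =
    av (si fz (fs fz) ≤-refl) (si (fs fz) (fs (fs fz)) ≤-refl) (si (fs (fs fz)) (fs (fs (fs fz))) ≤-refl)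
       (FP.toℕ<n (f (fs (fs (fs fz)))))
       (realise {τ = p3421} occ (fs (fs (fs fz))) (fs (fs fz)) refl)
       (realise {τ = p3421} occ (fs (fs fz)) fz refl)
       (realise {τ = p3421} occ fz (fs fz) refl)

  fwd213 : ∀ {i j l} (iN : i < n) (jN : j < n) (lN : l < n) → asFun w j < asFun w i → asFun w i < asFun w l →
           ∀ a b → lookup p213 a <F lookup p213 b → lookup w (f3 iN jN lN a) <F lookup w (f3 iN jN lN b)
  fwd213 iN jN lN h0 h1 fz fz (s≤s ())
  fwd213 iN jN lN h0 h1 fz (fs fz) ()
  fwd213 iN jN lN h0 h1 fz (fs (fs fz)) _ = vlt iN lN h1
  fwd213 iN jN lN h0 h1 (fs fz) fz _ = vlt jN iN h0
  fwd213 iN jN lN h0 h1 (fs fz) (fs fz) ()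
  fwd213 iN jN lN h0 h1 (fs fz) (fs (fs fz)) _ = vlt jN lN (<-trans h0 h1)
  fwd213 iN jN lN h0 h1 (fs (fs fz)) fz (s≤s ())
  fwd213 iN jN lN h0 h1 (fs (fs fz)) (fs fz) ()
  fwd213 iN jN lN h0 h1 (fs (fs fz)) (fs (fs fz)) (s≤s (s≤s ()))
  from213 : Avoids w p213 → Av213 n (asFun w)
  from213 av {i} {j} {l} ij jl lN h0 h1 =
    av (f3 iN jN lN , Pat.mkOcc p213 inj213 w (f3 iN jN lN) (si3 iN jN lN ij jl) (fwd213 iN jN lN h0 h1))
    where jN = <-trans jl lN
          iN = <-trans ij jN
  to213 : Av213 n (asFun w) → Avoids w p213
  to213 av (f , occ@(si , _)) =
    av (si fz (fs fz) ≤-refl) (si (fs fz) (fs (fs fz)) ≤-refl) (FP.toℕ<n (f (fs (fs fz))))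
       (realise {τ = p213} occ (fs fz) fz refl) (realise {τ = p213} occ fz (fs (fs fz)) refl)

  fwd4312 : ∀ {i j k l} (iN : i < n) (jN : j < n) (kN : k < n) (lN : l < n) →
            asFun w k < asFun w l → asFun w l < asFun w j → asFun w j < asFun w i →
            ∀ a b → lookup p4312 a <F lookup p4312 b → lookup w (f4 iN jN kN lN a) <F lookup w (f4 iN jN kN lN b)
  fwd4312 iN jN kN lN h0 h1 h2 fz fz (s≤s (s≤s (s≤s ())))
  fwd4312 iN jN kN lN h0 h1 h2 fz (fs fz) (s≤s (s≤s ()))
  fwd4312 iN jN kN lN h0 h1 h2 fz (fs (fs fz)) ()
  fwd4312 iN jN kN lN h0 h1 h2 fz (fs (fs (fs fz))) (s≤s ())
  fwd4312 iN jN kN lN h0 h1 h2 (fs fz) fz _ = vlt jN iN h2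
  fwd4312 iN jN kN lN h0 h1 h2 (fs fz) (fs fz) (s≤s (s≤s ()))
  fwd4312 iN jN kN lN h0 h1 h2 (fs fz) (fs (fs fz)) ()
  fwd4312 iN jN kN lN h0 h1 h2 (fs fz) (fs (fs (fs fz))) (s≤s ())
  fwd4312 iN jN kN lN h0 h1 h2 (fs (fs fz)) fz _ = vlt kN iN (<-trans (<-trans h0 h1) h2)
  fwd4312 iN jN kN lN h0 h1 h2 (fs (fs fz)) (fs fz) _ = vlt kN jN (<-trans h0 h1)
  fwd4312 iN jN kN lN h0 h1 h2 (fs (fs fz)) (fs (fs fz)) ()
  fwd4312 iN jN kN lN h0 h1 h2 (fs (fs fz)) (fs (fs (fs fz))) _ = vlt kN lN h0
  fwd4312 iN jN kN lN h0 h1 h2 (fs (fs (fs fz))) fz _ = vlt lN iN (<-trans h1 h2)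
  fwd4312 iN jN kN lN h0 h1 h2 (fs (fs (fs fz))) (fs fz) _ = vlt lN jN h1
  fwd4312 iN jN kN lN h0 h1 h2 (fs (fs (fs fz))) (fs (fs fz)) ()
  fwd4312 iN jN kN lN h0 h1 h2 (fs (fs (fs fz))) (fs (fs (fs fz))) (s≤s ())
  from4312 : Avoids w p4312 → Av4312 n (asFun w)
  from4312 av {i} {j} {k} {l} ij jk kl lN h0 h1 h2 =
    av (f4 iN jN kN lN , Pat.mkOcc p4312 inj4312 w (f4 iN jN kN lN) (si4 iN jN kN lN ij jk kl) (fwd4312 iN jN kN lN h0 h1 h2))
    where kN = <-trans kl lN
          jN = <-trans jk kN
          iN = <-trans ij jN
  to4312 : Av4312 n (asFun w) → Avoids w p4312
  to4312 av (f , occ@(si , _)) =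
    av (si fz (fs fz) ≤-refl) (si (fs fz) (fs (fs fz)) ≤-refl) (si (fs (fs fz)) (fs (fs (fs fz))) ≤-refl)
       (FP.toℕ<n (f (fs (fs (fs fz)))))
       (realise {τ = p4312} occ (fs (fs fz)) (fs (fs (fs fz))) refl)
       (realise {τ = p4312} occ (fs (fs (fs fz))) (fs fz) refl)
       (realise {τ = p4312} occ (fs fz) fz refl)

SAv132⇒Good : ∀ {n} (w : Word n) → InSAv p132 p3421 w → Good n (asFun w)
SAv132⇒Good w (ip , a , b , c , d) =
  asFun-range w , isPerm⇒Inj w ip , PatternBridge.from132 w a , PatternBridge.from3421 w b ,
  cong132 (asFun-square w) (PatternBridge.from132 (square w) c) , cong3421 (asFun-square w) (PatternBridge.from3421 (square w) d)

Good⇒SAv132 : ∀ {n} (w : Word n) → Good n (asFun w) → InSAv p132 p3421 w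
Good⇒SAv132 w (rg , ij , a1 , a2 , s1 , s2) =
  Inj⇒isPerm w ij , PatternBridge.to132 w a1 , PatternBridge.to3421 w a2 ,
  PatternBridge.to132 (square w) (cong132 (λ p → sym (asFun-square w p)) s1) ,
  PatternBridge.to3421 (square w) (cong3421 (λ p → sym (asFun-square w p)) s2)

SAv213⇒Good′ : ∀ {n} (w : Word n) → InSAv p213 p4312 w → Good′ n (asFun w)
SAv213⇒Good′ w (ip , a , b , c , d) =
  asFun-range w , isPerm⇒Inj w ip , PatternBridge.from213 w a , PatternBridge.from4312 w b ,
  cong213 (asFun-square w) (PatternBridge.from213 (square w) c) , cong4312 (asFun-square w) (PatternBridge.from4312 (square w) d)

Good′⇒SAv213 : ∀ {n} (w : Word n) → Good′ n (asFun w) → InSAv p213 p4312 w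
Good′⇒SAv213 w (rg , ij , a1 , a2 , s1 , s2) =
  Inj⇒isPerm w ij , PatternBridge.to213 w a1 , PatternBridge.to4312 w a2 ,
  PatternBridge.to213 (square w) (cong213 (λ p → sym (asFun-square w p)) s1) ,
  PatternBridge.to4312 (square w) (cong4312 (λ p → sym (asFun-square w p)) s2)

asWord-Good : ∀ {n g} → Good n g → InSAv p132 p3421 (asWord n g)
asWord-Good {n} {g} G = Good⇒SAv132 (asWord n g) (Good-cong G (λ q → sym (asFun-asWord g (proj₁ G) q)))

asWord-Good′ : ∀ {n g} → Good′ n g → InSAv p213 p4312 (asWord n g)
asWord-Good′ {n} {g} G = Good′⇒SAv213 (asWord n g) (Good′-cong G (λ q → sym (asFun-asWord g (proj₁ G) q)))



-- Reverse–complement.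

module RevComp (K : ℕ) where
  N : ℕ
  N = suc K

  rc : (ℕ → ℕ) → ℕ → ℕ
  rc g i = K ∸ g (K ∸ i)

  kN : ∀ i → K ∸ i < N
  kN i = s≤s (m∸n≤m K i)
  kk : ∀ {i} → i < N → K ∸ (K ∸ i) ≡ i
  kk iN = m∸[m∸n]≡n (≤-pred iN)
  rev : ∀ {x y} → x ≤ K → y ≤ K → K ∸ x < K ∸ y → y < x
  rev {x} {y} xK yK lt with <-cmp y x
  ... | tri< a _ _ = a
  ... | tri≈ _ refl _ = ⊥-elim (<-irrefl refl lt)
  ... | tri> _ _ c = ⊥-elim (<⇒≱ lt (∸-monoʳ-≤ K (<⇒≤ c)))
  fwd : ∀ {x y} → y ≤ K → x < y → K ∸ y < K ∸ x
  fwd yK xy = ∸-monoʳ-< xy yK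
  pos : ∀ {i j} → i < j → j < N → K ∸ j < K ∸ i
  pos ij jN = ∸-monoʳ-< ij (≤-pred jN)

  rcRng : ∀ g → Rng N (rc g)
  rcRng g {i} _ = kN (g (K ∸ i))
  rcInj : ∀ {g} → Rng N g → Inj N g → Inj N (rc g)
  rcInj {g} rg ij {i} {j} iN jN e =
    ∸-cancelˡ-≡ (≤-pred iN) (≤-pred jN) (ij (kN i) (kN j) (∸-cancelˡ-≡ (≤-pred (rg (kN i))) (≤-pred (rg (kN j))) e))
  rcInv : ∀ {g} → Rng N g → rc (rc g) ≈[ N ] g
  rcInv {g} rg {i} iN = trans (cong (λ x → K ∸ (K ∸ g x)) (kk iN)) (m∸[m∸n]≡n (≤-pred (rg iN)))
  rcSq : ∀ {g} → Rng N g → sq (rc g) ≈[ N ] rc (sq g)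
  rcSq {g} rg {i} iN = cong (λ x → K ∸ g x) (kk (rg (kN i)))
  rcCong : ∀ {f g} → f ≈[ N ] g → rc f ≈[ N ] rc g
  rcCong e {i} iN = cong (K ∸_) (e (kN i))

  t213→132 : ∀ {g} → Rng N g → Av213 N g → Av132 N (rc g)
  t213→132 {g} rg av {i} {j} {l} ij jl lN x y =
    av (pos jl lN) (pos ij (<-trans jl lN)) (kN i) (rev (r l) (r j) y) (rev (r i) (r l) x)
    where r : ∀ p → g (K ∸ p) ≤ K
          r p = ≤-pred (rg (kN p))

  t4312→3421 : ∀ {g} → Rng N g → Av4312 N g → Av3421 N (rc g)
  t4312→3421 {g} rg av {i} {j} {k} {l} ij jk kl lN x y z =
    av (pos kl lN) (pos jk (<-trans kl lN)) (pos ij (<-trans jk (<-trans kl lN))) (kN i)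
       (rev (r i) (r j) z) (rev (r k) (r i) y) (rev (r l) (r k) x)
    where r : ∀ p → g (K ∸ p) ≤ K
          r p = ≤-pred (rg (kN p))

  t132→213 : ∀ {g} → Rng N g → Av132 N (rc g) → Av213 N g
  t132→213 {g} rg av {a} {b} {c} ab bc cN x y =
    av (pos bc cN) (pos ab (<-trans bc cN)) (kN a)
      (subst₂ _<_ (e cN) (e aN) (fwd (≤-pred (rg cN)) y))
      (subst₂ _<_ (e aN) (e bN) (fwd (≤-pred (rg aN)) x))
    where bN = <-trans bc cN
          aN = <-trans ab bN
          e : ∀ {p} → p < N → K ∸ g p ≡ rc g (K ∸ p)
          e pN = sym (cong (λ q → K ∸ g q) (kk pN))

  t3421→4312 : ∀ {g} → Rng N g → Av3421 N (rc g) → Av4312 N g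
  t3421→4312 {g} rg av {a} {b} {c} {d} ab bc cd dN x y z =
    av (pos cd dN) (pos bc cN) (pos ab bN) (kN a)
      (subst₂ _<_ (e aN) (e bN) (fwd (≤-pred (rg aN)) z))
      (subst₂ _<_ (e bN) (e dN) (fwd (≤-pred (rg bN)) y))
      (subst₂ _<_ (e dN) (e cN) (fwd (≤-pred (rg dN)) x))
    where cN = <-trans cd dN
          bN = <-trans bc cN
          aN = <-trans ab bN
          e : ∀ {p} → p < N → K ∸ g p ≡ rc g (K ∸ p)
          e pN = sym (cong (λ q → K ∸ g q) (kk pN))

  rc-injective : ∀ {f g} → Rng N f → Rng N g → rc f ≈[ N ] rc g → f ≈[ N ] g
  rc-injective rf rg e iN = trans (sym (rcInv rf iN)) (trans (rcCong e iN) (rcInv rg iN))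

  Good′⇒Good : ∀ {g} → Good′ N g → Good N (rc g)
  Good′⇒Good {g} (rg , ij , a1 , a2 , b1 , b2) =
    rcRng g , rcInj rg ij , t213→132 rg a1 , t4312→3421 rg a2 ,
    cong132 (λ p → sym (rcSq rg p)) (t213→132 rg2 b1) , cong3421 (λ p → sym (rcSq rg p)) (t4312→3421 rg2 b2)
    where rg2 : Rng N (sq g)
          rg2 p = rg (rg p)

  Good⇒Good′ : ∀ {h} → Good N h → Good′ N (rc h)
  Good⇒Good′ {h} (rg , ij , a1 , a2 , b1 , b2) =
    rcRng h , rcInj rg ij ,
    t132→213 (rcRng h) (cong132 (λ p → sym (rcInv rg p)) a1) ,
    t3421→4312 (rcRng h) (cong3421 (λ p → sym (rcInv rg p)) a2) ,
    cong213 (λ p → sym (rcSq rg p)) (t132→213 (rcRng (sq h)) (cong132 (λ p → sym (rcInv rg2 p)) b1)) ,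
    cong4312 (λ p → sym (rcSq rg p)) (t3421→4312 (rcRng (sq h)) (cong3421 (λ p → sym (rcInv rg2 p)) b2))
    where rg2 : Rng N (sq h)
          rg2 p = rg (rg p)



-- Monotone runs.

neq-split : ∀ {a b} → a ≢ b → a < b ⊎ b < a
neq-split {a} {b} ne with <-cmp a b
... | tri< x _ _ = inj₁ x
... | tri≈ _ e _ = ⊥-elim (ne e)
... | tri> _ _ x = inj₂ x

module IncId (f : ℕ → ℕ) (a k c : ℕ)
  (inc : ∀ {i j} → a ≤ i → i < j → j < a + k → f i < f j)
  (lo : ∀ {i} → a ≤ i → i < a + k → c ≤ f i)
  (hi : ∀ {i} → a ≤ i → i < a + k → f i < c + k) where

  lower : ∀ t → t < k → c + t ≤ f (a + t)
  lower zero t<k rewrite +-identityʳ c = lo (m≤m+n a 0) (+-monoʳ-< a t<k)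
  lower (suc t) t<k = subst (_≤ f (a + suc t)) (sym (+-suc c t))
     (≤-<-trans (lower t (<-trans (n<1+n t) t<k))
        (inc (m≤m+n a t) (subst (a + t <_) (sym (+-suc a t)) (n<1+n (a + t))) (+-monoʳ-< a t<k)))

  -- from the top: the u entries after position a + t still need room below c + k
  upperAux : ∀ u t → suc (t + u) ≡ k → f (a + t) + u < c + k
  upperAux zero t e rewrite +-identityʳ (f (a + t)) =
     hi (m≤m+n a t) (+-monoʳ-< a (subst (t <_) e (subst (_< suc (t + 0)) (+-identityʳ t) (n<1+n (t + 0)))))
  upperAux (suc u) t e = ≤-<-trans step ih
    where
      e' : suc (suc t + u) ≡ k
      e' = trans (cong suc (sym (+-suc t u))) e
      ih : f (a + suc t) + u < c + k
      ih = upperAux u (suc t) e'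
      t1k : suc t < k
      t1k = subst (suc t <_) e' (s≤s (s≤s (m≤m+n t u)))
      fl : f (a + t) < f (a + suc t)
      fl = inc (m≤m+n a t) (subst (a + t <_) (sym (+-suc a t)) (n<1+n (a + t))) (+-monoʳ-< a t1k)
      step : f (a + t) + suc u ≤ f (a + suc t) + u
      step = subst (_≤ f (a + suc t) + u) (sym (+-suc (f (a + t)) u)) (+-monoˡ-≤ u fl)

  upper : ∀ t → t < k → f (a + t) ≤ c + t
  upper t t<k = ≤-pred (+-cancelʳ-≤ u (suc (f (a + t))) (suc (c + t)) le)
    where
      u = k ∸ suc t
      ek : suc (t + u) ≡ k
      ek = m+[n∸m]≡n t<k
      h = upperAux u t ek
      eq2 : c + k ≡ suc (c + t) + u
      eq2 = trans (cong (c +_) (sym ek)) (lem c t u)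
        where lem : ∀ c t u → c + suc (t + u) ≡ suc (c + t) + u
              lem = solve-∀
      le : suc (f (a + t)) + u ≤ suc (c + t) + u
      le = subst (suc (f (a + t)) + u ≤_) eq2 h

  incId : ∀ t → t < k → f (a + t) ≡ c + t
  incId t t<k = ≤-antisym (upper t t<k) (lower t t<k)

module DecId (f : ℕ → ℕ) (a k c : ℕ)
  (dec : ∀ {i j} → a ≤ i → i < j → j < a + k → f j < f i)
  (lo : ∀ {i} → a ≤ i → i < a + k → c ≤ f i)
  (hi : ∀ {i} → a ≤ i → i < a + k → f i < c + k) where

  -- the u entries after position a + t lie strictly below f (a + t)
  lowerAux : ∀ u t → suc (t + u) ≡ k → c + u ≤ f (a + t)
  lowerAux zero t e rewrite +-identityʳ c =
     lo (m≤m+n a t) (+-monoʳ-< a (subst (t <_) e (subst (_< suc (t + 0)) (+-identityʳ t) (n<1+n (t + 0)))))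
  lowerAux (suc u) t e = subst (_≤ f (a + t)) (sym (+-suc c u)) (≤-<-trans ih fl)
    where
      e' : suc (suc t + u) ≡ k
      e' = trans (cong suc (sym (+-suc t u))) e
      ih : c + u ≤ f (a + suc t)
      ih = lowerAux u (suc t) e'
      t1k : suc t < k
      t1k = subst (suc t <_) e' (s≤s (s≤s (m≤m+n t u)))
      fl : f (a + suc t) < f (a + t)
      fl = dec (m≤m+n a t) (subst (a + t <_) (sym (+-suc a t)) (n<1+n (a + t))) (+-monoʳ-< a t1k)

  -- the t entries before position a + t lie strictly above it
  upperD : ∀ t → t < k → f (a + t) + t < c + k
  upperD zero t<k rewrite +-identityʳ a | +-identityʳ (f a) = hi ≤-refl (subst (_< a + k) (+-identityʳ a) (+-monoʳ-< a t<k))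
  upperD (suc t) t<k = ≤-<-trans step (upperD t (<-trans (n<1+n t) t<k))
    where
      fl : f (a + suc t) < f (a + t)
      fl = dec (m≤m+n a t) (subst (a + t <_) (sym (+-suc a t)) (n<1+n (a + t))) (+-monoʳ-< a t<k)
      step : f (a + suc t) + suc t ≤ f (a + t) + t
      step = subst (_≤ f (a + t) + t) (sym (+-suc (f (a + suc t)) t)) (+-monoˡ-≤ t fl)

  decId : ∀ t → t < k → f (a + t) ≡ c + (k ∸ suc t)
  decId t t<k = ≤-antisym up (lowerAux u t ek)
    where
      u = k ∸ suc t
      ek : suc (t + u) ≡ k
      ek = m+[n∸m]≡n t<k
      h = upperD t t<k
      eq2 : c + k ≡ suc (c + u) + t
      eq2 = trans (cong (c +_) (sym ek)) (lem c t u)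
        where lem : ∀ c t u → c + suc (t + u) ≡ suc (c + u) + t
              lem = solve-∀
      up : f (a + t) ≤ c + u
      up = ≤-pred (+-cancelʳ-≤ t (suc (f (a + t))) (suc (c + u)) (subst (suc (f (a + t)) + t ≤_) eq2 h))

module BlockLow (n : ℕ) (π : ℕ → ℕ) (rg : Rng n π) (ij : Inj n π) (a : ℕ)
  (inc : ∀ {l l'} → a ≤ l → l < l' → l' < n → π l < π l')
  (low : ∀ {i l} → i < a → a ≤ l → l < n → π l < π i) where

  geq : ∀ t → a + t < n → t ≤ π (a + t)
  geq zero _ = z≤n
  geq (suc t) p = ≤-<-trans (geq t (<-trans (+-monoʳ-< a (n<1+n t)) p))
                    (inc (m≤m+n a t) (+-monoʳ-< a (n<1+n t)) p)

  -- the value t is taken somewhere; not before a (those values are larger), not at an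
  -- earlier tail position (those take 0 … t−1), not later (by monotonicity)
  core : ∀ t → (∀ t' → t' < t → a + t' < n → π (a + t') ≡ t') → a + t < n → π (a + t) ≡ t
  core t ih p = res
    where
      tn : t < n
      tn = ≤-<-trans (m≤n+m t a) p
      sv = inj⇒surj rg ij tn
      q = proj₁ sv
      q<n = proj₁ (proj₂ sv)
      πq = proj₂ (proj₂ sv)
      res : π (a + t) ≡ t
      res with q <? a
      ... | yes q<a = ⊥-elim (<⇒≱ (subst (π (a + t) <_) πq (low q<a (m≤m+n a t) p)) (geq t p))
      ... | no q≮a with <-cmp (q ∸ a) t
      ...   | tri< lt _ _ = ⊥-elim (<⇒≢ lt (trans (sym (ih (q ∸ a) lt (subst (_< n) (sym qa) q<n))) (trans (cong π qa) πq)))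
        where qa : a + (q ∸ a) ≡ q
              qa = m+[n∸m]≡n (≮⇒≥ q≮a)
      ...   | tri≈ _ e _ = trans (cong π (trans (cong (a +_) (sym e)) (m+[n∸m]≡n (≮⇒≥ q≮a)))) πq
      ...   | tri> _ _ gt = ⊥-elim (<⇒≱ (subst (π (a + t) <_) πq
                  (inc (m≤m+n a t) (subst (a + t <_) qa (+-monoʳ-< a gt)) q<n)) (geq t p))
        where qa : a + (q ∸ a) ≡ q
              qa = m+[n∸m]≡n (≮⇒≥ q≮a)

  main : ∀ t → (∀ t' → t' ≤ t → a + t' < n → π (a + t') ≡ t')
  main zero t' z≤n p = core zero (λ _ ()) p
  main (suc t) t' le p with m≤n⇒m<n∨m≡n le
  ... | inj₁ lt = main t t' (≤-pred lt) p
  ... | inj₂ refl = core (suc t) (λ t'' lt → main t t'' (≤-pred lt)) p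

  blockLow : ∀ t → a + t < n → π (a + t) ≡ t
  blockLow t p = main t t ≤-refl p

incGap : ∀ {f : ℕ → ℕ} {n a} → (∀ {l l'} → a ≤ l → l < l' → l' < n → f l < f l') →
         ∀ d → a + d < n → f a + d ≤ f (a + d)
incGap {f} {n} {a} inc zero p rewrite +-identityʳ a | +-identityʳ (f a) = ≤-refl
incGap {f} {n} {a} inc (suc d) p =
  subst (_≤ f (a + suc d)) (sym (+-suc (f a) d)) (≤-<-trans (incGap inc d (<-trans (+-monoʳ-< a (n<1+n d)) p))
     (inc (m≤m+n a d) (+-monoʳ-< a (n<1+n d)) p))

split132 : ∀ {h n} → Av132 n h → ∀ {i q l} → i < q → q < l → l < n → h l < h q → h i ≢ h l → h l < h i
split132 av iq ql ln lq ne with neq-split ne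
... | inj₁ x = ⊥-elim (av iq ql ln x lq)
... | inj₂ x = x

incAfter : ∀ {h n} → Av3421 n h → ∀ {i q l l'} → i < q → q < l → l < l' → l' < n →
           h l < h i → h i < h q → h l ≢ h l' → h l < h l'
incAfter av iq ql ll' l'n li iq' ne with neq-split ne
... | inj₁ x = x
... | inj₂ x = ⊥-elim (av iq ql ll' l'n x li iq')

after0 : ∀ {h n} → Av132 n h → ∀ {z l l'} → z < l → l < l' → l' < n → h z < h l' → h l ≢ h l' → h l < h l'
after0 av zl ll' l'n zl' ne with neq-split ne
... | inj₁ x = x
... | inj₂ x = ⊥-elim (av zl ll' l'n zl' x)



-- The core lemma.  The middle part of a frame permutation is a reversed prefix
-- j (j−1) ⋯ 1 (j+1) ⋯ m.  A permutation of [1, m] avoiding 132 and 231 is such a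
-- reversed prefix provided it satisfies the "key" condition KeyC coming from the square.

ascent⇒increasing : ∀ {g a b} → Av132I a b g → Av231I a b g → (∀ {i j} → a ≤ i → i < j → j < b → g i ≢ g j) →
     g a < g (suc a) → ∀ {i j} → a ≤ i → i < j → j < b → g i < g j
ascent⇒increasing {g} {a} {b} a132 a231 ne g01 {i} {j} ai ij jb = res
  where
    claim0 : ∀ {j} → a < j → j < b → g a < g j
    claim0 {j} aj jb with m≤n⇒m<n∨m≡n aj
    ... | inj₂ refl = g01
    ... | inj₁ sa<j with neq-split (ne ≤-refl aj jb)
    ...   | inj₁ x = x
    ...   | inj₂ gj<ga = ⊥-elim (a231 ≤-refl (n<1+n a) sa<j jb gj<ga g01)
    res : g i < g j
    res with m≤n⇒m<n∨m≡n ai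
    ... | inj₂ refl = claim0 ij jb
    ... | inj₁ a<i with neq-split (ne ai ij jb)
    ...   | inj₁ x = x
    ...   | inj₂ gj<gi = ⊥-elim (a132 ≤-refl a<i ij jb (claim0 (<-trans a<i ij) jb) gj<gi)

endsMax : ∀ {g a b i p l} → Av132I a b g → Av231I a b g → a ≤ i → i < p → p < l → l < b →
          g i < g p → g l < g p → g i ≢ g l → ⊥
endsMax a132 a231 ai ip pl lb gip glp ne with neq-split ne
... | inj₁ x = a132 ai ip pl lb x glp
... | inj₂ x = a231 ai ip pl lb x gip

revPrefix : ℕ → ℕ → ℕ
revPrefix j i with i ≤? j
... | yes _ = suc j ∸ i
... | no _ = i

revPrefix-≤ : ∀ {j i} → i ≤ j → revPrefix j i ≡ suc j ∸ i
revPrefix-≤ {j} {i} le with i ≤? j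
... | yes _ = refl
... | no ¬p = ⊥-elim (¬p le)

revPrefix-> : ∀ {j i} → j < i → revPrefix j i ≡ i
revPrefix-> {j} {i} lt with i ≤? j
... | yes p = ⊥-elim (<⇒≱ lt p)
... | no _ = refl

revPrefix-dec : ∀ {j i k} → i < k → k ≤ j → revPrefix j k < revPrefix j i
revPrefix-dec {j} {i} {k} ik kj =
  subst₂ _<_ (sym (revPrefix-≤ kj)) (sym (revPrefix-≤ (≤-trans (<⇒≤ ik) kj))) (∸-monoʳ-< ik (≤-trans kj (n≤1+n j)))

revPrefix-range : ∀ {m j} → j ≤ m → ∀ {i} → 1 ≤ i → i ≤ m → 1 ≤ revPrefix j i × revPrefix j i ≤ m
revPrefix-range {m} {j} jm {i} 1i im with ≤-<-connex i j
... | inj₁ ij = subst (1 ≤_) (sym (revPrefix-≤ ij)) (subst (1 ≤_) (sym (+-∸-assoc 1 ij)) (s≤s z≤n)) ,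
               subst (_≤ m) (sym (revPrefix-≤ ij)) (≤-trans (∸-monoʳ-≤ (suc j) 1i) jm)
... | inj₂ ij = subst (1 ≤_) (sym (revPrefix-> ij)) 1i , subst (_≤ m) (sym (revPrefix-> ij)) im

revPrefix-132 : ∀ {m j} → Av132I 1 (suc m) (revPrefix j)
revPrefix-132 {m} {j} {i} {k} {l} 1i ik kl lm x y with ≤-<-connex k j
... | inj₁ kj = <-asym (<-trans x y) (revPrefix-dec ik kj)
... | inj₂ kj = <-asym y (subst₂ _<_ (sym (revPrefix-> kj)) (sym (revPrefix-> (<-trans kj kl))) kl)

revPrefix-231 : ∀ {m j} → Av231I 1 (suc m) (revPrefix j)
revPrefix-231 {m} {j} {i} {k} {l} 1i ik kl lm x y with ≤-<-connex k j
... | inj₁ kj = <-asym y (revPrefix-dec ik kj)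
... | inj₂ kj = <-asym (<-trans x y) (subst₂ _<_ (sym (revPrefix-> kj)) (sym (revPrefix-> (<-trans kj kl))) kl)

revPrefix-invol : ∀ {j i} → 1 ≤ i → revPrefix j (revPrefix j i) ≡ i
revPrefix-invol {j} {i} 1i with ≤-<-connex i j
... | inj₁ ij = trans (cong (revPrefix j) (revPrefix-≤ ij)) (trans (revPrefix-≤ le) (m∸[m∸n]≡n (≤-trans ij (n≤1+n j))))
  where le : suc j ∸ i ≤ j
        le = ∸-monoʳ-≤ (suc j) 1i
... | inj₂ ij = trans (cong (revPrefix j) (revPrefix-> ij)) (revPrefix-> ij)

module CoreShape (γ : ℕ → ℕ) where
  RngC : ℕ → Set
  RngC m = ∀ {i} → 1 ≤ i → i ≤ m → 1 ≤ γ i × γ i ≤ m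
  InjC : ℕ → Set
  InjC m = ∀ {i j} → 1 ≤ i → i ≤ m → 1 ≤ j → j ≤ m → γ i ≡ γ j → i ≡ j
  KeyC : ℕ → Set
  KeyC m = ∀ m' → 2 ≤ m' → m' ≤ m → (∀ {i} → 1 ≤ i → i ≤ m' → γ i ≤ m') → γ 1 ≡ m' → γ m' ≡ 1
  Res : ℕ → Set
  Res m = ∃ λ j → 1 ≤ j × j ≤ m × (∀ {i} → 1 ≤ i → i ≤ m → γ i ≡ revPrefix j i)

  -- By induction on m, according to the position p of the maximum value m:
  -- p = m: γ restricts to [1, m−1];  p = 1: then γ m = 1 by the key condition and γ is
  -- decreasing;  1 < p < m: impossible by endsMax.
  coreShape : ∀ m → 1 ≤ m → RngC m → InjC m → Av132I 1 (suc m) γ → Av231I 1 (suc m) γ → KeyC m → Res m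
  go : ∀ m0 → (RngC (suc m0) → InjC (suc m0) → Av132I 1 (suc (suc m0)) γ → Av231I 1 (suc (suc m0)) γ → KeyC (suc m0) → Res (suc m0)) →
       RngC (suc (suc m0)) → InjC (suc (suc m0)) → Av132I 1 (suc (suc (suc m0))) γ → Av231I 1 (suc (suc (suc m0))) γ → KeyC (suc (suc m0)) →
       ∀ p → 1 ≤ p → p ≤ suc (suc m0) → γ p ≡ suc (suc m0) → Res (suc (suc m0))
  coreShape (suc zero) _ rg _ _ _ _ = 1 , ≤-refl , ≤-refl , f
    where
      f : ∀ {i} → 1 ≤ i → i ≤ 1 → γ i ≡ revPrefix 1 i
      f {i} 1i i1 with ≤-antisym i1 1i
      ... | refl = ≤-antisym (proj₂ (rg ≤-refl ≤-refl)) (proj₁ (rg ≤-refl ≤-refl))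
  coreShape (suc (suc m0)) _ rg ij a132 a231 key =
    let p , 1p , pM , γp = inj⇒surj₁ rg ij {suc (suc m0)} (s≤s z≤n) ≤-refl
    in go m0 (coreShape (suc m0) (s≤s z≤n)) rg ij a132 a231 key p 1p pM γp

  go m0 IH rg ij a132 a231 key p 1p pM γp with m≤n⇒m<n∨m≡n pM
  ... | inj₂ refl = j , 1j , ≤-trans jm (n≤1+n _) , eqs
    where
      rg' : RngC (suc m0)
      rg' {i} 1i im = proj₁ (rg 1i (≤-trans im (n≤1+n _))) ,
          ≤-pred (≤∧≢⇒< (proj₂ (rg 1i (≤-trans im (n≤1+n _))))
             (λ e → <⇒≢ (s≤s im) (ij 1i (≤-trans im (n≤1+n _)) 1p pM (trans e (sym γp)))))
      ij' : InjC (suc m0)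
      ij' 1i im 1j jm e = ij 1i (≤-trans im (n≤1+n _)) 1j (≤-trans jm (n≤1+n _)) e
      a132' : Av132I 1 (suc (suc m0)) γ
      a132' ai ij jl lb = a132 ai ij jl (m<n⇒m<1+n lb)
      a231' : Av231I 1 (suc (suc m0)) γ
      a231' ai ij jl lb = a231 ai ij jl (m<n⇒m<1+n lb)
      key' : KeyC (suc m0)
      key' m' 2m' m'm = key m' 2m' (≤-trans m'm (n≤1+n _))
      ih = IH rg' ij' a132' a231' key'
      j = proj₁ ih
      1j = proj₁ (proj₂ ih)
      jm = proj₁ (proj₂ (proj₂ ih))
      eqs : ∀ {i} → 1 ≤ i → i ≤ (suc (suc m0)) → γ i ≡ revPrefix j i
      eqs {i} 1i iM with m≤n⇒m<n∨m≡n iM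
      ... | inj₁ i<M = proj₂ (proj₂ (proj₂ ih)) 1i (≤-pred i<M)
      ... | inj₂ refl = trans γp (sym (revPrefix-> (s≤s jm)))
  ... | inj₁ p<M with p ≟ 1
  ...   | no p≢1 = ⊥-elim (endsMax a132 a231 ≤-refl (≤∧≢⇒< 1p (λ e → p≢1 (sym e))) p<M (n<1+n (suc (suc m0)))
             (subst (γ 1 <_) (sym γp) (≤∧≢⇒< (proj₂ (rg ≤-refl (s≤s z≤n)))
                  (λ e → p≢1 (sym (ij ≤-refl (s≤s z≤n) 1p pM (trans e (sym γp)))))))
             (subst (γ (suc (suc m0)) <_) (sym γp) (≤∧≢⇒< (proj₂ (rg (s≤s z≤n) ≤-refl))
                  (λ e → <⇒≢ p<M (sym (ij (s≤s z≤n) ≤-refl 1p pM (trans e (sym γp)))))))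
             (λ e → <⇒≢ (s≤s (s≤s z≤n)) (ij ≤-refl (s≤s z≤n) (s≤s z≤n) ≤-refl e)))
  ...   | yes refl = (suc (suc m0)) , s≤s z≤n , ≤-refl , eqs
    where
      γM1 : γ (suc (suc m0)) ≡ 1
      γM1 = key (suc (suc m0)) (s≤s (s≤s z≤n)) ≤-refl (λ 1i iM → proj₂ (rg 1i iM)) γp
      dec : ∀ {i l} → 1 ≤ i → i < l → l < 1 + (suc (suc m0)) → γ l < γ i
      dec {i} {l} 1i il lM with neq-split (λ e → <⇒≢ il (ij 1i (≤-pred (m<n⇒m<1+n (<-≤-trans il (≤-pred lM))))
                               (≤-trans 1i (<⇒≤ il)) (≤-pred lM) e))
      ... | inj₂ x = x
      ... | inj₁ gi<gl with m≤n⇒m<n∨m≡n (≤-pred lM)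
      ...   | inj₂ refl = ⊥-elim (<⇒≱ (subst (γ i <_) γM1 gi<gl) (proj₁ (rg 1i (<⇒≤ (<-≤-trans il (≤-pred lM))))))
      ...   | inj₁ l<M = ⊥-elim (a231 1i il l<M (n<1+n (suc (suc m0)))
                  (subst (_< γ i) (sym γM1) (≤∧≢⇒< (proj₁ (rg 1i (<⇒≤ (<-trans il l<M))))
                      (λ e → <⇒≢ (<-trans il l<M) (ij 1i (<⇒≤ (<-trans il l<M)) (s≤s z≤n) ≤-refl (trans (sym e) (sym γM1))))))
                  gi<gl)
      open DecId γ 1 (suc (suc m0)) 1 dec (λ 1i iM → proj₁ (rg 1i (≤-pred iM))) (λ 1i iM → s≤s (proj₂ (rg 1i (≤-pred iM))))
      eqs : ∀ {i} → 1 ≤ i → i ≤ (suc (suc m0)) → γ i ≡ revPrefix (suc (suc m0)) i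
      eqs {suc t} (s≤s _) iM = trans (decId t iM) (trans (sym (+-∸-assoc 1 iM)) (sym (revPrefix-≤ iM)))



-- The catalogue.  'Code' names the permutations of the classification and 'den n c'
-- is the permutation of [0, n) denoted by c:  'ext c' appends a fixed point, 'rot s'
-- is i ↦ i + s mod n, 'dec' is the decreasing permutation, and 'fg j', 'fha j', 'fhb j'
-- are frames: a value at position 0, the reversed prefix revPrefix j on positions
-- 1 … m, and two values at positions m+1, m+2 (where n = m + 3).

frame : ℕ → ℕ → ℕ → ℕ → (ℕ → ℕ) → ℕ → ℕ
frame m a b c γ zero = a
frame m a b c γ (suc i) with i <? m
... | yes _ = γ (suc i)
... | no _ with i ≟ m
...   | yes _ = b
...   | no _ = c

frame-mid : ∀ {m a b c γ i} → 1 ≤ i → i ≤ m → frame m a b c γ i ≡ γ i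
frame-mid {m} {i = suc i} _ im with i <? m
... | yes _ = refl
... | no ¬p = ⊥-elim (¬p im)

frame-b : ∀ {m a b c γ} → frame m a b c γ (suc m) ≡ b
frame-b {m} with m <? m
... | yes p = ⊥-elim (<-irrefl refl p)
... | no _ with m ≟ m
...   | yes _ = refl
...   | no ¬p = ⊥-elim (¬p refl)

frame-c : ∀ {m a b c γ} → frame m a b c γ (suc (suc m)) ≡ c
frame-c {m} with suc m <? m
... | yes p = ⊥-elim (<-asym p (n<1+n m))
... | no _ with suc m ≟ m
...   | yes e = ⊥-elim (<-irrefl (sym e) (n<1+n m))
...   | no _ = refl

frame-position : ∀ {m p} → p < suc (suc (suc m)) → (p ≡ 0) ⊎ ((1 ≤ p × p ≤ m) ⊎ ((p ≡ suc m) ⊎ (p ≡ suc (suc m))))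
frame-position {p = zero} _ = inj₁ refl
frame-position {p = suc p} pN with m≤n⇒m<n∨m≡n (≤-pred pN)
... | inj₂ e = inj₂ (inj₂ (inj₂ e))
... | inj₁ lt with m≤n⇒m<n∨m≡n (≤-pred lt)
...   | inj₂ e = inj₂ (inj₂ (inj₁ e))
...   | inj₁ lt' = inj₂ (inj₁ (s≤s z≤n , ≤-pred lt'))

frame-ext : ∀ {m a b c γ} (h : ℕ → ℕ) → h 0 ≡ a → (∀ {i} → 1 ≤ i → i ≤ m → h i ≡ γ i) →
            h (suc m) ≡ b → h (suc (suc m)) ≡ c → h ≈[ suc (suc (suc m)) ] frame m a b c γ
frame-ext {m} {a} {b} {c} {γ} h e0 em eb ec iN with frame-position {m} iN
... | inj₁ refl = e0
... | inj₂ (inj₁ (1i , im)) = trans (em 1i im) (sym (frame-mid {m} {a} {b} {c} {γ} 1i im))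
... | inj₂ (inj₂ (inj₁ refl)) = trans eb (sym (frame-b {m} {a} {b} {c} {γ}))
... | inj₂ (inj₂ (inj₂ refl)) = trans ec (sym (frame-c {m} {a} {b} {c} {γ}))

data Code : Set where
  ext : Code → Code
  rot : ℕ → Code
  dec : Code
  fg fha fhb : ℕ → Code

extend : ℕ → (ℕ → ℕ) → ℕ → ℕ
extend n g i with i ≟ n
... | yes _ = n
... | no _ = g i

-- den n c is the permutation of [0, n) named by c (codes of the wrong size denote the
-- identity; they never occur in 'codes n').
den : ℕ → Code → ℕ → ℕ
den (suc n) (ext c) = extend n (den n c)
den (suc n) (rot s) = λ i → (i + s) % suc n
den (suc n) dec = λ i → n ∸ i
den (suc (suc (suc m))) (fg j) = frame m (suc m) (suc (suc m)) 0 (revPrefix j)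
den (suc (suc (suc m))) (fha j) = frame m (suc (suc m)) 0 (suc m) (revPrefix j)
den (suc (suc (suc m))) (fhb j) = frame m (suc (suc m)) (suc m) 0 (revPrefix j)
den _ _ = λ i → i

extend-last : ∀ {n g} → extend n g n ≡ n
extend-last {n} with n ≟ n
... | yes _ = refl
... | no ¬p = ⊥-elim (¬p refl)

extend-< : ∀ {n g i} → i < n → extend n g i ≡ g i
extend-< {n} {g} {i} lt with i ≟ n
... | yes e = ⊥-elim (<-irrefl e lt)
... | no _ = refl

range : ℕ → ℕ → List ℕ
range a zero = []
range a (suc k) = a ∷ range (suc a) k

length-range : ∀ a k → length (range a k) ≡ k
length-range a zero = refl
length-range a (suc k) = cong suc (length-range (suc a) k)

∈-range : ∀ {a k x} → a ≤ x → x < a + k → x ∈ range a k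
∈-range {a} {zero} {x} ax xk = ⊥-elim (<⇒≱ (subst (x <_) (+-identityʳ a) xk) ax)
∈-range {a} {suc k} {x} ax xk with m≤n⇒m<n∨m≡n ax
... | inj₂ refl = here refl
... | inj₁ a<x = there (∈-range a<x (subst (x <_) (+-suc a k) xk))

∈-range⁻ : ∀ {a k x} → x ∈ range a k → a ≤ x × x < a + k
∈-range⁻ {a} {suc k} (here refl) = ≤-refl , subst (a <_) (sym (+-suc a k)) (s≤s (m≤m+n a k))
∈-range⁻ {a} {suc k} {x} (there p) with ∈-range⁻ {suc a} {k} p
... | l , u = <⇒≤ l , subst (x <_) (sym (+-suc a k)) u

-- The primitive codes of size n, i.e. those whose last entry is not fixed.
E : ℕ → List Code
E zero = []
E (suc zero) = dec ∷ []
E (suc (suc zero)) = dec ∷ []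
E (suc (suc (suc m))) = map rot (range 1 (suc (suc m))) ++ (dec ∷ (map fg (range 1 m) ++ (map fha (range 1 m) ++ map fhb (range 1 m))))

codes : ℕ → List Code
codes zero = []
codes (suc n) = map ext (codes n) ++ E (suc n)

mem-ext : ∀ {n c} → c ∈ codes n → ext c ∈ codes (suc n)
mem-ext m = ∈-++⁺ˡ (∈-map⁺ ext m)

mem-E : ∀ {n c} → c ∈ E n → c ∈ codes n
mem-E {suc n} m = ∈-++⁺ʳ _ m

mem-rot : ∀ {m s} → 1 ≤ s → s ≤ suc (suc m) → rot s ∈ E (suc (suc (suc m)))
mem-rot 1s sm = ∈-++⁺ˡ (∈-map⁺ rot (∈-range 1s (s≤s sm)))

mem-dec : ∀ {m} → dec ∈ E (suc (suc (suc m)))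
mem-dec {m} = ∈-++⁺ʳ (map rot (range 1 (suc (suc m)))) (here refl)

mem-fg : ∀ {m j} → 1 ≤ j → j ≤ m → fg j ∈ E (suc (suc (suc m)))
mem-fg {m} 1j jm = ∈-++⁺ʳ (map rot (range 1 (suc (suc m)))) (there (∈-++⁺ˡ (∈-map⁺ fg (∈-range 1j (s≤s jm)))))

mem-fha : ∀ {m j} → 1 ≤ j → j ≤ m → fha j ∈ E (suc (suc (suc m)))
mem-fha {m} 1j jm =
  ∈-++⁺ʳ (map rot (range 1 (suc (suc m)))) (there (∈-++⁺ʳ (map fg (range 1 m)) (∈-++⁺ˡ (∈-map⁺ fha (∈-range 1j (s≤s jm))))))

mem-fhb : ∀ {m j} → 1 ≤ j → j ≤ m → fhb j ∈ E (suc (suc (suc m)))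
mem-fhb {m} 1j jm =
  ∈-++⁺ʳ (map rot (range 1 (suc (suc m))))
    (there (∈-++⁺ʳ (map fg (range 1 m)) (∈-++⁺ʳ (map fha (range 1 m)) (∈-map⁺ fhb (∈-range 1j (s≤s jm))))))

rot-lo : ∀ n s i → i + s < suc n → (i + s) % suc n ≡ i + s
rot-lo n s i lt = m≤n⇒m%n≡m (≤-pred lt)

rot-hi : ∀ n t → t < suc n → (t + suc n) % suc n ≡ t
rot-hi n t lt = trans ([m+n]%n≡m%n t (suc n)) (m≤n⇒m%n≡m (≤-pred lt))

-- |E (m+3)| = (m+2) + 1 + 3m = 4n − 9.
length-map-range : ∀ (f : ℕ → Code) a k → length (map f (range a k)) ≡ k
length-map-range f a k = trans (length-map f (range a k)) (length-range a k)

length-E : ∀ m → length (E (suc (suc (suc m)))) ≡ suc (suc m) + suc (m + (m + m))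
length-E m =
  trans (length-++ (map rot (range 1 (suc (suc m)))))
    (cong₂ _+_ (length-map-range rot 1 (suc (suc m)))
      (cong suc (trans (length-++ (map fg (range 1 m)))
        (cong₂ _+_ (length-map-range fg 1 m)
          (trans (length-++ (map fha (range 1 m)))
            (cong₂ _+_ (length-map-range fha 1 m) (length-map-range fhb 1 m)))))))

length-codes-suc : ∀ n → length (codes (suc n)) ≡ length (codes n) + length (E (suc n))
length-codes-suc n = trans (length-++ (map ext (codes n))) (cong (_+ length (E (suc n))) (length-map ext (codes n)))

length-codes+7n : ∀ m → length (codes (suc (suc m))) + 7 * suc (suc m) ≡ 2 * suc (suc m) * suc (suc m) + 8
length-codes+7n zero = refl
length-codes+7n (suc m) = trans (cong (_+ 7 * (3 + m)) (trans (length-codes-suc (suc (suc m))) (cong (length (codes (suc (suc m))) +_) (length-E m))))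
                (trans (l1 (length (codes (suc (suc m)))) m) (trans (cong (_+ (4 * m + 10)) (length-codes+7n m)) (l2 m)))
  where
    l1 : ∀ L m → (L + (suc (suc m) + suc (m + (m + m)))) + 7 * (3 + m) ≡ (L + 7 * (2 + m)) + (4 * m + 10)
    l1 = solve-∀
    l2 : ∀ m → (2 * (2 + m) * (2 + m) + 8) + (4 * m + 10) ≡ 2 * (3 + m) * (3 + m) + 8
    l2 = solve-∀

length-codes : ∀ n → 2 ≤ n → length (codes n) ≡ (2 * n * n + 8) ∸ 7 * n
length-codes (suc zero) (s≤s ())
length-codes (suc (suc m)) _ = trans (sym (m+n∸n≡m (length (codes (suc (suc m)))) (7 * suc (suc m)))) (cong (_∸ 7 * suc (suc m)) (length-codes+7n m))



-- Completeness: every Good permutation is denoted by a code.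

2+[m∸1]≡1+m : ∀ m {i} → 2 ≤ i → i < 2 + (m ∸ 1) → 2 + (m ∸ 1) ≡ suc m
2+[m∸1]≡1+m zero 2i lt = ⊥-elim (<⇒≱ lt 2i)
2+[m∸1]≡1+m (suc m) _ _ = refl

2+[m∸1∸1+t]≡m∸t : ∀ m t → 2 + t ≤ m → 2 + ((m ∸ 1) ∸ suc t) ≡ m ∸ t
2+[m∸1∸1+t]≡m∸t zero t ()
2+[m∸1∸1+t]≡m∸t (suc m1) t (s≤s le) = trans (cong suc (sym (+-∸-assoc 1 le))) (sym (+-∸-assoc 1 (≤-trans (n≤1+n t) le)))

≤m⇒<2+[m∸1] : ∀ m {i} → 2 ≤ i → i ≤ m → i < 2 + (m ∸ 1)
≤m⇒<2+[m∸1] zero (s≤s (s≤s _)) ()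
≤m⇒<2+[m∸1] (suc m) 2i im = s≤s im

-- The primitive case: a Good permutation of [0, m+3) whose last entry is not fixed is
-- a rotation, 'dec' or a frame.  The case split is on the position of the maximum.
module Classify (m : ℕ) (π : ℕ → ℕ) (G : Good (suc (suc (suc m))) π) where
  N M : ℕ
  N = suc (suc (suc m))
  M = suc (suc m)

  rg : Rng N π
  rg = proj₁ G
  ij : Inj N π
  ij = proj₁ (proj₂ G)
  a132 : Av132 N π
  a132 = proj₁ (proj₂ (proj₂ G))
  a3421 : Av3421 N π
  a3421 = proj₁ (proj₂ (proj₂ (proj₂ G)))
  b132 : Av132 N (sq π)
  b132 = proj₁ (proj₂ (proj₂ (proj₂ (proj₂ G))))
  b3421 : Av3421 N (sq π)
  b3421 = proj₂ (proj₂ (proj₂ (proj₂ (proj₂ G))))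

  rg2 : Rng N (sq π)
  rg2 p = rg (rg p)
  ij2 : Inj N (sq π)
  ij2 p q e = ij p q (ij (rg p) (rg q) e)

  sj : Surj N π
  sj = inj⇒surj rg ij

  MN : M < N
  MN = n<1+n M

  leN : ∀ {i} → i ≤ m → i < N
  leN im = ≤-<-trans im (m<n+m m {3} (s≤s z≤n))

  lsN : ∀ {i} → i ≤ suc m → i < N
  lsN im = ≤-<-trans im (m<n+m (suc m) {2} (s≤s z≤n))

  nev : ∀ {x y v} → x < N → y < N → π y ≡ v → x ≢ y → π x ≢ v
  nev xN yN e ne e' = ne (ij xN yN (trans e' (sym e)))

  nev2 : ∀ {x y v} → x < N → y < N → sq π y ≡ v → x ≢ y → sq π x ≢ v
  nev2 xN yN e ne e' = ne (ij2 xN yN (trans e' (sym e)))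

  ltM : ∀ {x} → x < N → x ≢ M → x < M
  ltM xN ne = ≤∧≢⇒< (≤-pred xN) ne

  ltSm : ∀ {x} → x < N → x ≢ M → x ≢ suc m → x < suc m
  ltSm xN ne ne' = ≤∧≢⇒< (≤-pred (ltM xN ne)) ne'

  Result : Set
  Result = ∃ λ c → c ∈ E N × (∀ {i} → i < N → π i ≡ den N c i)

  coreInj : CoreShape.InjC π m
  coreInj 1i im 1j jm e = ij (leN im) (leN jm) e

  core132 : Av132I 1 (suc m) π
  core132 _ ij' jl lb = a132 ij' jl (leN (≤-pred lb))

  keyFromSq : (∀ {i} → 1 ≤ i → i ≤ m → 1 ≤ π i × π i ≤ m) →
              Av231I 1 (suc m) (sq π) → CoreShape.KeyC π m
  -- Let v be the position of the value 1 in [1, m'].  If v < m' and π² m' ≠ m', then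
  -- π² 1 and π² m' are distinct and both below π² v = m', which endsMax forbids.
  keyFromSq crg s231 m' 2m' m'm hyp π1 =
    let v , 1v , vm' , πv = inj⇒surj₁ rg' ij' {1} ≤-refl 1m' in go v 1v vm' πv
    where
      iN : ∀ {i} → i ≤ m → i < N
      iN = leN
      m'N : m' < N
      m'N = iN m'm
      1m' : 1 ≤ m'
      1m' = ≤-trans (s≤s z≤n) 2m'
      rg' : ∀ {i} → 1 ≤ i → i ≤ m' → 1 ≤ π i × π i ≤ m'
      rg' 1i im = proj₁ (crg 1i (≤-trans im m'm)) , hyp 1i im
      ij' : ∀ {i j} → 1 ≤ i → i ≤ m' → 1 ≤ j → j ≤ m' → π i ≡ π j → i ≡ j
      ij' _ im _ jm e = ij (iN (≤-trans im m'm)) (iN (≤-trans jm m'm)) e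
      s132 : Av132I 1 (suc m) (sq π)
      s132 _ a b c = b132 a b (leN (≤-pred c))
      1N : 1 < N
      1N = s≤s (s≤s z≤n)
      π1≢1 : π 1 ≢ 1
      π1≢1 e = <-irrefl (trans (sym e) π1) 2m'
      go : ∀ v → 1 ≤ v → v ≤ m' → π v ≡ 1 → π m' ≡ 1
      go v 1v vm' πv with m≤n⇒m<n∨m≡n vm'
      ... | inj₂ refl = πv
      ... | inj₁ v<m' with sq π m' ≟ m'
      ...   | yes e = ij (rg m'N) 1N (trans e (sym π1))
      ...   | no ne = ⊥-elim (endsMax s132 s231 ≤-refl 1<v v<m' (s≤s m'm) l1 l2 ne12)
        where
          1<v : 1 < v
          1<v = ≤∧≢⇒< 1v (λ e → π1≢1 (subst (λ x → π x ≡ 1) (sym e) πv))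
          sqv : sq π v ≡ m'
          sqv = trans (cong π πv) π1
          πm'≤ : π m' ≤ m'
          πm'≤ = hyp 1m' ≤-refl
          l1 : sq π 1 < sq π v
          l1 = subst (sq π 1 <_) (sym sqv) (≤∧≢⇒< (subst (_≤ m') (cong π (sym π1)) πm'≤)
                  (λ e → <-irrefl (sym (ij m'N 1N (trans (trans (sym (cong π π1)) e) (sym π1)))) 2m'))
          l2 : sq π m' < sq π v
          l2 = subst (sq π m' <_) (sym sqv) (≤∧≢⇒< (hyp (proj₁ (crg 1m' m'm)) πm'≤) ne)
          ne12 : sq π 1 ≢ sq π m'
          ne12 e = <-irrefl (ij 1N m'N (ij (rg 1N) (rg m'N) e)) 2m'

  coreFrame : 1 ≤ m → (∀ {i} → 1 ≤ i → i ≤ m → 1 ≤ π i × π i ≤ m) → Av231I 1 (suc m) π →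
              CoreShape.KeyC π m → ∀ {a b c} → π 0 ≡ a → π (suc m) ≡ b → π M ≡ c →
              ∃ λ j → 1 ≤ j × j ≤ m × π ≈[ N ] frame m a b c (revPrefix j)
  coreFrame 1m crg c231 key e0 eb ec =
    let j , 1j , jm , core = CoreShape.coreShape π m 1m crg coreInj core132 c231 key
    in j , 1j , jm , frame-ext π e0 core eb ec

  -- The maximum M sits at position q ≥ 1, followed by s' + 1 further positions.
  -- Everything after q lies below everything before q (132), and increases (3421),
  -- so the tail after q is 0, 1, …, s' and the prefix takes the values s'+1 … s'+q.
  module MaxAt (q s' : ℕ) (e : q + s' ≡ suc m) (1q : 1 ≤ q) (πq : π q ≡ M) where
    qM : q < M
    qM = s≤s (subst (q ≤_) e (m≤m+n q s'))
    qN : q < N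
    qN = <-trans qM MN
    ne-q : ∀ {l} → l < N → l ≢ q → π l < M
    ne-q lN ne = ltM (rg lN) (nev lN qN πq ne)
    tailBelowPrefix : ∀ {i l} → i < q → q < l → l < N → π l < π i
    tailBelowPrefix {i} {l} iq ql lN = split132 a132 iq ql lN (subst (π l <_) (sym πq) (ne-q lN (λ e → <-irrefl (sym e) ql)))
        (λ e → <-irrefl (ij (<-trans iq (<-trans ql lN)) lN e) (<-trans iq ql))
    π0M : π 0 < M
    π0M = ne-q (<-trans 1q qN) (λ e → <-irrefl e 1q)
    tailIncreasing : ∀ {l l'} → suc q ≤ l → l < l' → l' < N → π l < π l'
    tailIncreasing {l} {l'} ql ll' l'N = incAfter a3421 1q ql ll' l'N (tailBelowPrefix 1q ql (<-trans ll' l'N)) (subst (π 0 <_) (sym πq) π0M)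
        (λ e → <-irrefl (ij (<-trans ll' l'N) l'N e) ll')
    lowB : ∀ {i l} → i < suc q → suc q ≤ l → l < N → π l < π i
    lowB {i} {l} i<sq ql lN with m≤n⇒m<n∨m≡n (≤-pred i<sq)
    ... | inj₁ i<q = tailBelowPrefix i<q ql lN
    ... | inj₂ refl = subst (π l <_) (sym πq) (ne-q lN (λ e → <-irrefl (sym e) ql))
    open BlockLow N π rg ij (suc q) tailIncreasing lowB public
    sqs : suc q + s' ≡ M
    sqs = cong suc e
    πlast : π M ≡ s'
    πlast = subst (λ x → π x ≡ s') sqs (blockLow s' (subst (_< N) (sym sqs) MN))
    prefixAbove : ∀ {i} → i < q → suc s' ≤ π i
    prefixAbove i<q = subst (_< _) πlast (tailBelowPrefix i<q qM MN)
    sqM : suc s' + q ≡ M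
    sqM = cong suc (trans (+-comm s' q) e)
    qsM : q + suc s' ≡ M
    qsM = trans (+-suc q s') (cong suc e)
    prefixBelow : ∀ {i} → i < q → π i < suc s' + q
    prefixBelow {i} i<q = subst (π i <_) (sym sqM) (ne-q (<-trans i<q qN) (λ e → <-irrefl e i<q))
    s'≤ : suc s' ≤ suc (suc m)
    s'≤ = s≤s (subst (s' ≤_) e (m≤n+m s' q))

    -- if the prefix is increasing, π is the rotation by s' + 1
    fromInc : (∀ {i j} → 0 ≤ i → i < j → j < 0 + q → π i < π j) → Result
    fromInc inc = rot (suc s') , mem-rot (s≤s z≤n) s'≤ , eqs
      where
        open IncId π 0 q (suc s') inc (λ _ iq → prefixAbove iq) (λ _ iq → prefixBelow iq)
        eqs : ∀ {i} → i < N → π i ≡ den N (rot (suc s')) i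
        eqs {i} iN with <-cmp i q
        ... | tri< i<q _ _ = trans (incId i i<q) (trans (+-comm (suc s') i) (sym (rot-lo (suc (suc m)) (suc s') i lt)))
          where lt : i + suc s' < N
                lt = <-trans (subst (i + suc s' <_) qsM (+-monoˡ-< (suc s') i<q)) MN
        ... | tri≈ _ refl _ = trans πq (sym (trans (rot-lo (suc (suc m)) (suc s') q (subst (_< N) (sym qsM) MN)) qsM))
        ... | tri> _ _ q<i = trans (trans (cong π (sym eqi)) (blockLow t (subst (_< N) (sym eqi) iN)))
                                (sym (trans (cong (λ x → x % N) eqv) (rot-hi (suc (suc m)) t tN)))
          where
            t = i ∸ suc q
            eqi : suc q + t ≡ i
            eqi = m+[n∸m]≡n q<i
            tN : t < N
            tN = ≤-<-trans (m∸n≤m i (suc q)) iN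
            eqv : i + suc s' ≡ t + N
            eqv = trans (cong (_+ suc s') (sym eqi)) (trans (lem q t s') (cong (t +_) (cong suc qsM)))
              where lem : ∀ q t s' → suc q + t + suc s' ≡ t + suc (q + suc s')
                    lem = solve-∀

    -- the prefix increases up to position s': an inversion there would give a 132 in π²,
    -- which maps the tail position q+1+j to π j
    pairInc : ∀ {i j} → i < j → j ≤ s' → j < q → π i < π j
    pairInc {i} {j} i<j js' jq with neq-split (λ e → <-irrefl (ij (<-trans i<j (<-trans jq qN)) (<-trans jq qN) e) i<j)
    ... | inj₁ x = x
    ... | inj₂ x = ⊥-elim (b132 (≤-trans (s≤s (m≤m+n q i)) ≤-refl) (+-monoʳ-< (suc q) i<j) CN
                      (subst (_< sq π (suc q + j)) (sym (trans (cong π πq) πlast)) (subst (s' <_) (sym eC) (prefixAbove jq)))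
                      (subst₂ _<_ (sym eC) (sym eB) x))
      where
        CN : suc q + j < N
        CN = ≤-<-trans (subst (suc q + j ≤_) sqs (+-monoʳ-≤ (suc q) js')) MN
        BN : suc q + i < N
        BN = <-trans (+-monoʳ-< (suc q) i<j) CN
        eC : sq π (suc q + j) ≡ π j
        eC = cong π (blockLow j CN)
        eB : sq π (suc q + i) ≡ π i
        eB = cong π (blockLow i BN)

    -- the prefix avoids 132 and 231, so an initial ascent already makes it increasing
    c132 : Av132I 0 q π
    c132 _ a b c = a132 a b (<-trans c qN)
    c231 : Av231I 0 q π
    c231 {i} {j} {l} _ a b c x y = a3421 a b (<-trans c qM) MN (subst (_< π l) (sym πlast) (prefixAbove c)) x y
    cne : ∀ {i j} → 0 ≤ i → i < j → j < q → π i ≢ π j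
    cne _ i<j jq e = <-irrefl (ij (<-trans i<j (<-trans jq qN)) (<-trans jq qN) e) i<j

    viaAscent : 1 < q → π 0 < π 1 → Result
    viaAscent 1<q p01 = fromInc (λ {i} {j} ai ij' jq → ascent⇒increasing c132 c231 cne p01 ai ij' jq)

  -- Case q = m + 1 (so π M = 0): the value m + 1 is at position 0, and π is a frame
  -- of type G, or at position m, and π is a rotation; anywhere else π 0 and π m would
  -- be distinct entries flanking it.
  module MaxBeforeLast (e : suc m + 0 ≡ suc m) (πq : π (suc m) ≡ M) (gt : ¬ (suc m ≤ 1)) where
    open MaxAt (suc m) 0 e (s≤s z≤n) πq
    1m : 1 ≤ m
    1m = ≤-pred (≰⇒> gt)
    πM0 : π M ≡ 0
    πM0 = πlast
    smN : suc m < N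
    smN = <-trans (n<1+n _) MN

    frameG : π 0 ≡ suc m → Result
    frameG πp = let j , 1j , jm , eqs = coreFrame 1m crg core231 (keyFromSq crg s231) πp πq πM0
                in fg j , mem-fg 1j jm , eqs
      where
        crg : ∀ {i} → 1 ≤ i → i ≤ m → 1 ≤ π i × π i ≤ m
        crg {i} 1i im = prefixAbove (s≤s im) , ≤-pred (≤∧≢⇒< (≤-pred (prefixBelow (s≤s im)))
                            (nev (leN im) (s≤s z≤n) πp (λ e' → <-irrefl (sym e') 1i)))
        core231 : Av231I 1 (suc m) π
        core231 {i} {j} {l} a b c d x y = a3421 b c (<-trans d (n<1+n _)) MN
            (subst (_< π l) (sym πM0) (proj₁ (crg (≤-trans a (<⇒≤ (<-trans b c))) (≤-pred d)))) x y
        s231 : Av231I 1 (suc m) (sq π)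
        s231 {i} {j} {l} a b c d x y = b3421 b c d smN
            (subst (_< sq π l) (sym (trans (cong π πq) πM0)) (proj₁ (crg (proj₁ cl) (proj₂ cl)))) x y
          where
            cl : 1 ≤ π l × π l ≤ m
            cl = crg (≤-trans a (<⇒≤ (<-trans b c))) (≤-pred d)

    -- the value 1 sits before position m, so an inversion π 1 < π 0 would give a 132 in π²
    rotation : π m ≡ suc m → Result
    rotation πp = viaAscent (s≤s 1m) p01
      where
        p01 : π 0 < π 1
        p01 with sj {1} (s≤s (s≤s z≤n))
        ... | i1 , i1N , πi1 with neq-split (λ e' → <-irrefl (ij (s≤s z≤n) (s≤s (s≤s z≤n)) e') (s≤s z≤n))
        ...   | inj₁ x = x
        ...   | inj₂ x = ⊥-elim (b132 i1<m (<-trans (n<1+n _) (n<1+n _)) MN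
                  (subst₂ _<_ (sym (cong π πi1)) (sym (cong π πM0)) x)
                  (subst₂ _<_ (sym (cong π πM0)) (sym (trans (cong π πp) πq)) π0M))
          where
            i1≢M : i1 ≢ M
            i1≢M e' = <-irrefl (trans (sym πM0) (trans (cong π (sym e')) πi1)) (s≤s z≤n)
            i1≢sm : i1 ≢ suc m
            i1≢sm e' = <-irrefl (trans (sym πi1) (trans (cong π e') πq)) (s≤s (s≤s z≤n))
            i1<m : i1 < m
            i1<m = ≤∧≢⇒< (≤-pred (ltSm i1N i1≢M i1≢sm))
                    (λ e' → <-irrefl (trans (sym πi1) (trans (cong π e') πp)) (s≤s 1m))

    impossible : ∀ {p} → p < N → π p ≡ suc m → p ≢ 0 → p ≢ m → ⊥
    impossible {p} pN πp p≢0 p≢m = endsMax c132 c231 z≤n 0<p p<m (n<1+n m) l1 l2 ne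
      where
        p≢M : p ≢ M
        p≢M e' = <-irrefl (trans (sym πM0) (trans (cong π (sym e')) πp)) (s≤s z≤n)
        p≢sm : p ≢ suc m
        p≢sm e' = <-irrefl (trans (sym πp) (trans (cong π e') πq)) (n<1+n _)
        0<p : 0 < p
        0<p = ≤∧≢⇒< z≤n (λ e' → p≢0 (sym e'))
        p<m : p < m
        p<m = ≤∧≢⇒< (≤-pred (ltSm pN p≢M p≢sm)) p≢m
        l1 : π 0 < π p
        l1 = subst (π 0 <_) (sym πp) (≤∧≢⇒< (≤-pred π0M) (nev (s≤s z≤n) pN πp (λ e' → p≢0 (sym e'))))
        l2 : π m < π p
        l2 = subst (π m <_) (sym πp) (≤∧≢⇒< (≤-pred (ne-q (leN ≤-refl) (λ e' → <-irrefl e' (n<1+n m))))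
               (nev (leN ≤-refl) pN πp (λ e' → p≢m (sym e'))))
        ne : π 0 ≢ π m
        ne e' = <-irrefl (ij (s≤s z≤n) (leN ≤-refl) e') 1m

  maxBeforeLast : suc m + 0 ≡ suc m → π (suc m) ≡ M → ¬ (suc m ≤ 1) → Result
  maxBeforeLast e πq gt with sj {suc m} (<-trans (n<1+n _) MN)
  ... | p , pN , πp with p ≟ 0 | p ≟ m
  ...   | yes refl | _ = MaxBeforeLast.frameG e πq gt πp
  ...   | no _ | yes refl = MaxBeforeLast.rotation e πq gt πp
  ...   | no p≢0 | no p≢m = ⊥-elim (MaxBeforeLast.impossible e πq gt pN πp p≢0 p≢m)

  -- The maximum at position q ≥ 1: π is a rotation unless q = m + 1.
  maxAt : ∀ q s' → q + s' ≡ suc m → 1 ≤ q → π q ≡ M → Result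
  maxAt q s' e 1q πq with q ≤? suc s'
  ... | yes le = MaxAt.fromInc q s' e 1q πq (λ {i} {j} _ ij' jq → MaxAt.pairInc q s' e 1q πq ij' (≤-pred (≤-trans jq le)) jq)
  maxAt q (suc s'') e 1q πq | no gt = MaxAt.viaAscent q (suc s'') e 1q πq 1<q (MaxAt.pairInc q (suc s'') e 1q πq (n<1+n 0) (s≤s z≤n) 1<q)
    where
      1<q : 1 < q
      1<q = ≤-trans (s≤s (s≤s z≤n)) (<⇒≤ (≰⇒> gt))
  maxAt q zero e 1q πq | no gt with trans (sym (+-identityʳ q)) e
  ... | refl = maxBeforeLast e πq gt

  module SquareTail (z : ℕ) (zN : z < N) (1z : 1 ≤ z) (sqz : sq π z ≡ M) (s0M : sq π 0 < M) where
    ne2M : ∀ {l} → l < N → l ≢ z → sq π l < M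
    ne2M lN ne = ltM (rg2 lN) (nev2 lN zN sqz ne)
    splitS : ∀ {i l} → i < z → z < l → l < N → sq π l < sq π i
    splitS {i} {l} iz zl lN = split132 b132 iz zl lN (subst (sq π l <_) (sym sqz) (ne2M lN (λ e → <-irrefl (sym e) zl)))
        (λ e → <-irrefl (ij2 (<-trans iz zN) lN e) (<-trans iz zl))
    incS : ∀ {l l'} → suc z ≤ l → l < l' → l' < N → sq π l < sq π l'
    incS {l} {l'} zl ll' l'N = incAfter b3421 1z zl ll' l'N (splitS 1z zl (<-trans ll' l'N))
        (subst (sq π 0 <_) (sym sqz) s0M) (λ e → <-irrefl (ij2 (<-trans ll' l'N) l'N e) ll')
    lowS : ∀ {i l} → i < suc z → suc z ≤ l → l < N → sq π l < sq π i
    lowS {i} {l} isz zl lN with m≤n⇒m<n∨m≡n (≤-pred isz)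
    ... | inj₁ iz = splitS iz zl lN
    ... | inj₂ refl = subst (sq π l <_) (sym sqz) (ne2M lN (λ e → <-irrefl (sym e) zl))
    open BlockLow N (sq π) rg2 ij2 (suc z) incS lowS public
    πsz : suc z < N → π z ≡ 0 → π (suc z) ≡ z
    πsz szN πz =
      ij (rg szN) zN (trans (subst (λ x → sq π x ≡ 0) (+-identityʳ (suc z))
                               (blockLow 0 (subst (_< N) (sym (+-identityʳ (suc z))) szN))) (sym πz))

  -- The maximum at position 0.  The case split is on the position of the value m + 1.
  module MaxFirst (π0 : π 0 ≡ M) where
    0N : 0 < N
    0N = s≤s z≤n
    1N : 1 < N
    1N = s≤s (s≤s z≤n)
    smN : suc m < N
    smN = <-trans (n<1+n _) MN
    s≢0 : ∀ {k} → suc k ≢ 0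
    s≢0 ()

    sqIdL : π M ≡ 0 → ∀ {t} → t < N → sq π t ≡ t
    sqIdL πM0 {t} tN = incId t tN
      where
        s0 : sq π 0 ≡ 0
        s0 = trans (cong π π0) πM0
        pos : ∀ {j} → 0 < j → j < N → 0 < sq π j
        pos {j} 0j jN = ≤∧≢⇒< z≤n (λ e → <-irrefl (ij2 0N jN (trans s0 e)) 0j)
        inc : ∀ {i j} → 0 ≤ i → i < j → j < 0 + N → sq π i < sq π j
        inc {i} {j} _ i<j jN with i ≟ 0
        ... | yes refl = subst (_< sq π j) (sym s0) (pos i<j jN)
        ... | no i≢0 = after0 b132 0<i i<j jN (subst (_< sq π j) (sym s0) (pos (<-trans 0<i i<j) jN))
                         (λ e → <-irrefl (ij2 (<-trans i<j jN) jN e) i<j)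
          where 0<i : 0 < i
                0<i = ≤∧≢⇒< z≤n (λ e → i≢0 (sym e))
        open IncId (sq π) 0 N 0 inc (λ _ _ → z≤n) (λ _ iN → rg2 iN)

    -- Case π M = m + 1; let z be the position of 0.  Then π² has its maximum at z.
    module SecondMaxLast (πM : π M ≡ suc m) (z : ℕ) (zN : z < N) (πz : π z ≡ 0) where
      z≢0 : z ≢ 0
      z≢0 e = s≢0 (trans (sym π0) (trans (cong π (sym e)) πz))
      z≢M : z ≢ M
      z≢M e = s≢0 (trans (sym πM) (trans (cong π (sym e)) πz))
      1z : 1 ≤ z
      1z = ≤∧≢⇒< z≤n (λ e → z≢0 (sym e))
      zsm : z ≤ suc m
      zsm = ≤-pred (ltM zN z≢M)
      sqz : sq π z ≡ M
      sqz = trans (cong π πz) π0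
      s0M : sq π 0 < M
      s0M = subst (_< M) (sym (trans (cong π π0) πM)) (n<1+n _)
      open SquareTail z zN 1z sqz s0M

      -- z = 1: the tail of π² after 1 is 0, 1, …, which forces π i = i − 1, a rotation
      rotation : z ≡ 1 → Result
      rotation refl = rot M , mem-rot (s≤s z≤n) ≤-refl , eqs
        where
          down : ∀ u t → t + u ≡ suc m → π (suc t) ≡ t
          down zero t e = subst (λ x → π (suc x) ≡ x) (sym (trans (sym (+-identityʳ t)) e)) πM
          down (suc u) t e = trans (cong π (sym ih)) bl
            where
              ih : π (suc (suc t)) ≡ suc t
              ih = down u (suc t) (trans (sym (+-suc t u)) e)
              tlt : t < suc m
              tlt = subst (t <_) e (m<m+n t (s≤s z≤n))
              bl : sq π (suc (suc t)) ≡ t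
              bl = blockLow t (s≤s (s≤s tlt))
          eqs : ∀ {i} → i < N → π i ≡ den N (rot M) i
          eqs {zero} _ = trans π0 (sym (rot-lo (suc (suc m)) M 0 MN))
          eqs {suc t} iN = trans (down (suc m ∸ t) t (m+[n∸m]≡n (≤-pred (≤-pred iN))))
                             (sym (trans (cong (λ x → x % N) (lem t m)) (rot-hi (suc (suc m)) t (<-trans (n<1+n t) iN))))
            where
              lem : ∀ t m → suc t + suc (suc m) ≡ t + suc (suc (suc m))
              lem = solve-∀

      frameHa : z ≢ 1 → z ≡ suc m → Result
      frameHa z≢1 refl = let j , 1j , jm , eqs = coreFrame 1m crg core231 (keyFromSq crg s231) π0 πz πM
                         in fha j , mem-fha 1j jm , eqs
        where
          1m : 1 ≤ m
          1m = ≤∧≢⇒< z≤n (λ e → z≢1 (cong suc (sym e)))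
          crg : ∀ {i} → 1 ≤ i → i ≤ m → 1 ≤ π i × π i ≤ m
          crg {i} 1i im = ≤∧≢⇒< z≤n (λ e → nev (leN im) zN πz (λ e' → <-irrefl e' (s≤s im)) (sym e)) ,
               ≤-pred (ltSm (rg (leN im)) (nev (leN im) 0N π0 (λ e' → <-irrefl (sym e') 1i))
                                          (nev (leN im) MN πM (λ e' → <-irrefl e' (<-trans (s≤s im) (n<1+n _)))))
          core231 : Av231I 1 (suc m) π
          core231 {i} {j} {l} a b c d x y = a3421 b c d smN
              (subst (_< π l) (sym πz) (proj₁ (crg (≤-trans a (<⇒≤ (<-trans b c))) (≤-pred d)))) x y
          s231 : Av231I 1 (suc m) (sq π)
          s231 {i} {j} {l} a b c d x y = b3421 b c (<-trans d (n<1+n _)) MN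
              (subst (_< sq π l) (sym (trans (cong π πM) πz)) (proj₁ (crg (proj₁ cl) (proj₂ cl)))) x y
            where
              cl : 1 ≤ π l × π l ≤ m
              cl = crg (≤-trans a (<⇒≤ (<-trans b c))) (≤-pred d)

      -- 1 < z < m + 1: π increases after z, yet would have to climb from π (z+1) = z
      -- to π (m+1), which is only one more than the number of steps
      impossible : z ≢ 1 → z ≢ suc m → ⊥
      impossible z≢1 z≢sm = <⇒≱ 2z (+-cancelʳ-≤ w' z 1 gap')
        where
          2z : 2 ≤ z
          2z = ≤∧≢⇒< 1z (λ e → z≢1 (sym e))
          z<sm : z < suc m
          z<sm = ≤∧≢⇒< zsm z≢sm
          incπ : ∀ {l l'} → suc z ≤ l → l < l' → l' < N → π l < π l'
          incπ {l} {l'} zl ll' l'N = after0 a132 zl ll' l'N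
             (subst (_< π l') (sym πz) (≤∧≢⇒< z≤n (λ e → nev l'N zN πz (λ e' → <-irrefl (sym e') (<-trans zl ll')) (sym e))))
             (λ e → <-irrefl (ij (<-trans ll' l'N) l'N e) ll')
          w' : ℕ
          w' = suc m ∸ suc z
          ew : suc z + w' ≡ suc m
          ew = m+[n∸m]≡n z<sm
          eM : suc z + suc w' ≡ M
          eM = trans (+-suc (suc z) w') (cong suc ew)
          πsm : π (suc m) ≡ suc w'
          πsm = trans (cong π (sym πM)) (subst (λ x → sq π x ≡ suc w') eM (blockLow (suc w') (subst (_< N) (sym eM) MN)))
          gap : π (suc z) + w' ≤ π (suc z + w')
          gap = incGap incπ w' (subst (_< N) (sym ew) smN)
          gap' : z + w' ≤ 1 + w'
          gap' = subst₂ _≤_ (cong (_+ w') (πsz (<-trans (s≤s z<sm) MN) πz)) (trans (cong π ew) πsm) gap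

    secondMaxLast : π M ≡ suc m → Result
    secondMaxLast πM with sj {0} 0N
    ... | z , zN , πz with z ≟ 1 | z ≟ suc m
    ...   | yes z≡1 | _ = SecondMaxLast.rotation πM z zN πz z≡1
    ...   | no z≢1 | yes z≡sm = SecondMaxLast.frameHa πM z zN πz z≢1 z≡sm
    ...   | no z≢1 | no z≢sm = ⊥-elim (SecondMaxLast.impossible πM z zN πz z≢1 z≢sm)

    -- Case: the value m + 1 at a position q' in [2, m + 1).  As in MaxAt the tail after q'
    -- is 0, 1, …; this is only consistent with π² avoiding 132 when q' = m + 1,
    -- and then π is a frame of type Hb.
    module SecondMaxMiddle (q' s' : ℕ) (e : q' + s' ≡ suc m) (2q : 2 ≤ q') (πq : π q' ≡ suc m) where
      q'N : q' < N
      q'N = lsN (subst (q' ≤_) e (m≤m+n q' s'))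
      q'M : q' < M
      q'M = s≤s (subst (q' ≤_) e (m≤m+n q' s'))
      ne-sm : ∀ {l} → l < N → l ≢ 0 → l ≢ q' → π l < suc m
      ne-sm lN l0 lq = ltSm (rg lN) (nev lN 0N π0 l0) (nev lN q'N πq lq)
      splitB : ∀ {i l} → 1 ≤ i → i < q' → q' < l → l < N → π l < π i
      splitB {i} {l} 1i iq ql lN = split132 a132 iq ql lN
          (subst (π l <_) (sym πq) (ne-sm lN (λ e' → <-irrefl (sym e') (≤-<-trans z≤n ql)) (λ e' → <-irrefl (sym e') ql)))
          (λ e' → <-irrefl (ij (<-trans iq (<-trans ql lN)) lN e') (<-trans iq ql))
      incB : ∀ {l l'} → suc q' ≤ l → l < l' → l' < N → π l < π l'
      incB {l} {l'} ql ll' l'N = incAfter a3421 2q ql ll' l'N (splitB ≤-refl 2q ql (<-trans ll' l'N))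
          (subst (π 1 <_) (sym πq) (ne-sm 1N (λ ()) (λ e' → <-irrefl e' 2q)))
          (λ e' → <-irrefl (ij (<-trans ll' l'N) l'N e') ll')
      lowB : ∀ {i l} → i < suc q' → suc q' ≤ l → l < N → π l < π i
      lowB {i} {l} isq ql lN with i ≟ 0
      ... | yes refl = subst (π l <_) (sym π0) (ltM (rg lN) (nev lN 0N π0 (λ e' → <-irrefl (sym e') (≤-<-trans z≤n ql))))
      ... | no i≢0 with m≤n⇒m<n∨m≡n (≤-pred isq)
      ...   | inj₁ iq = splitB (≤∧≢⇒< z≤n (λ e' → i≢0 (sym e'))) iq ql lN
      ...   | inj₂ refl = subst (π l <_) (sym πq) (ne-sm lN (λ e' → <-irrefl (sym e') (≤-<-trans z≤n ql)) (λ e' → <-irrefl (sym e') ql))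
      open BlockLow N π rg ij (suc q') incB lowB public
      sqs : suc q' + s' ≡ M
      sqs = cong suc e
      πlast : π M ≡ s'
      πlast = subst (λ x → π x ≡ s') sqs (blockLow s' (subst (_< N) (sym sqs) MN))

    -- if s' ≥ 1, the positions 0 < q'+1 < q'+2 carry a 132 in π²
    secondMaxMiddle : ∀ q' s' → q' + s' ≡ suc m → 2 ≤ q' → π q' ≡ suc m → Result
    secondMaxMiddle q' (suc s'') e 2q πq = ⊥-elim (b132 {0} {suc q'} {suc q' + 1} (s≤s z≤n) (m<m+n (suc q') (s≤s z≤n)) CN
          (subst₂ _<_ (sym (trans (cong π π0) πlast)) (sym (cong π (blockLow 1 CN)))
             (subst (_< π 1) πlast (splitB ≤-refl 2q q'M MN)))
          (subst₂ _<_ (sym (cong π (blockLow 1 CN))) (sym (trans (cong π πsq) π0))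
             (ltM (rg 1N) (nev 1N 0N π0 (λ ())))))
      where
        open SecondMaxMiddle q' (suc s'') e 2q πq
        CN : suc q' + 1 < N
        CN = ≤-<-trans (subst (suc q' + 1 ≤_) sqs (+-monoʳ-≤ (suc q') (s≤s z≤n))) MN
        πsq : π (suc q') ≡ 0
        πsq = subst (λ x → π x ≡ 0) (+-identityʳ (suc q'))
                (blockLow 0 (subst (_< N) (sym (+-identityʳ (suc q'))) (<-trans (m<m+n (suc q') (s≤s z≤n)) CN)))
    -- if s' = 0, then π M = 0, π² is the identity, the key condition holds trivially
    -- and π is a frame of type Hb
    secondMaxMiddle q' zero e 2q πq with trans (sym (+-identityʳ q')) e
    ... | refl = let j , 1j , jm , eqs = coreFrame 1m crg core231 key π0 πq πM0
                 in fhb j , mem-fhb 1j jm , eqs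
      where
        open SecondMaxMiddle (suc m) zero e 2q πq
        πM0 : π M ≡ 0
        πM0 = πlast
        sqid : ∀ {t} → t < N → sq π t ≡ t
        sqid = sqIdL πM0
        1m : 1 ≤ m
        1m = ≤-pred 2q
        crg : ∀ {i} → 1 ≤ i → i ≤ m → 1 ≤ π i × π i ≤ m
        crg {i} 1i im = ≤∧≢⇒< z≤n (λ e' → nev (leN im) MN πM0 (λ e'' → <-irrefl e'' (<-trans (s≤s im) (n<1+n _))) (sym e')) ,
             ≤-pred (ne-sm (leN im) (λ e' → <-irrefl (sym e') 1i) (λ e' → <-irrefl e' (s≤s im)))
        core231 : Av231I 1 (suc m) π
        core231 {i} {j} {l} a b c d x y = a3421 b c (<-trans d (n<1+n _)) MN
            (subst (_< π l) (sym πM0) (proj₁ (crg (≤-trans a (<⇒≤ (<-trans b c))) (≤-pred d)))) x y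
        key : CoreShape.KeyC π m
        key m' _ _ _ π1 = trans (cong π (sym π1)) (sqid 1N)

    -- Case π 1 = m + 1 and π M = 0: π² is the identity, π (m+1) = 1, and π decreases on
    -- the middle block, so π is the decreasing permutation.
    module Decreasing (π1 : π 1 ≡ suc m) (πM0 : π M ≡ 0) where
      sqid : ∀ {t} → t < N → sq π t ≡ t
      sqid = sqIdL πM0
      πsm : π (suc m) ≡ 1
      πsm = trans (cong π (sym π1)) (sqid 1N)
      rng2 : ∀ {i} → 2 ≤ i → i ≤ m → 2 ≤ π i × π i ≤ m
      rng2 {i} 2i im = ≤∧≢⇒< (≤∧≢⇒< z≤n (λ e → nev iN MN πM0 (λ e' → <-irrefl e' (<-trans (s≤s im) (n<1+n _))) (sym e)))
                              (λ e → nev iN smN πsm (λ e' → <-irrefl e' (s≤s im)) (sym e)) ,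
                       ≤-pred (ltSm (rg iN) (nev iN 0N π0 (λ e → <-irrefl (sym e) (≤-trans (s≤s z≤n) 2i)))
                                            (nev iN 1N π1 (λ e → <-irrefl (sym e) 2i)))
        where iN = leN im
      toM : ∀ {i} → 2 ≤ i → i < 2 + (m ∸ 1) → i ≤ m
      toM {i} 2i lt = ≤-pred (subst (i <_) (2+[m∸1]≡1+m m 2i lt) lt)
      decr : ∀ {i l} → 2 ≤ i → i < l → l < 2 + (m ∸ 1) → π l < π i
      decr {i} {l} 2i il lk with neq-split (λ e → <-irrefl (ij (leN (≤-trans (<⇒≤ il) lm)) (leN lm) e) il)
        where lm = toM (≤-trans 2i (<⇒≤ il)) lk
      ... | inj₂ x = x
      ... | inj₁ x = ⊥-elim (a3421 il (s≤s lm) (n<1+n _) MN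
             (subst₂ _<_ (sym πM0) (sym πsm) (s≤s z≤n))
             (subst (_< π i) (sym πsm) (proj₁ (rng2 2i (≤-trans (<⇒≤ il) lm)))) x)
        where
          lm = toM (≤-trans 2i (<⇒≤ il)) lk
      open DecId π 2 (m ∸ 1) 2 decr (λ 2i lt → proj₁ (rng2 2i (toM 2i lt)))
            (λ {i} 2i lt → subst (π i <_) (sym (2+[m∸1]≡1+m m 2i lt)) (s≤s (proj₂ (rng2 2i (toM 2i lt)))))
      eqs : ∀ {i} → i < N → π i ≡ den N dec i
      eqs {zero} _ = π0
      eqs {suc zero} _ = π1
      eqs {suc (suc t)} iN with m≤n⇒m<n∨m≡n (≤-pred iN)
      ... | inj₂ refl = trans πM0 (sym (n∸n≡0 m))
      ... | inj₁ lt with m≤n⇒m<n∨m≡n (≤-pred lt)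
      ...   | inj₂ refl = trans πsm (sym (m+n∸n≡m 1 t))
      ...   | inj₁ lt' = trans (decId t tk) (2+[m∸1∸1+t]≡m∸t m t (≤-pred lt'))
        where tk : t < m ∸ 1
              tk = ≤-pred (≤-pred (≤m⇒<2+[m∸1] m (s≤s (s≤s z≤n)) (≤-pred lt')))

      decreasing : Result
      decreasing = dec , mem-dec , eqs

    -- Case π 1 = m + 1 with 0 at a position z < M: the increasing run after z cannot
    -- reach π M < m + 1.
    zeroEarly : π 1 ≡ suc m → ∀ z → z < N → π z ≡ 0 → z ≢ M → ⊥
    zeroEarly π1 z zN πz z≢M = <⇒≱ πMlt (subst (_≤ π M) zd gap')
      where
        z≢0 : z ≢ 0
        z≢0 e = s≢0 (trans (sym π0) (trans (cong π (sym e)) πz))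
        z≢1 : z ≢ 1
        z≢1 e = s≢0 (trans (sym π1) (trans (cong π (sym e)) πz))
        1z : 1 ≤ z
        1z = ≤∧≢⇒< z≤n (λ e → z≢0 (sym e))
        zM : z < M
        zM = ltM zN z≢M
        sqz : sq π z ≡ M
        sqz = trans (cong π πz) π0
        M≢0 : M ≢ 0
        M≢0 ()
        s0M : sq π 0 < M
        s0M = subst (_< M) (sym (cong π π0)) (ltM (rg MN) (nev MN 0N π0 M≢0))
        open SquareTail z zN 1z sqz s0M
        incπ : ∀ {l l'} → suc z ≤ l → l < l' → l' < N → π l < π l'
        incπ {l} {l'} zl ll' l'N = after0 a132 zl ll' l'N
           (subst (_< π l') (sym πz) (≤∧≢⇒< z≤n (λ e → nev l'N zN πz (λ e' → <-irrefl (sym e') (<-trans zl ll')) (sym e))))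
           (λ e → <-irrefl (ij (<-trans ll' l'N) l'N e) ll')
        d : ℕ
        d = M ∸ suc z
        ed : suc z + d ≡ M
        ed = m+[n∸m]≡n zM
        gap : π (suc z) + d ≤ π (suc z + d)
        gap = incGap incπ d (subst (_< N) (sym ed) MN)
        gap' : z + d ≤ π M
        gap' = subst₂ _≤_ (cong (_+ d) (πsz (s≤s zM) πz)) (cong π ed) gap
        zd : z + d ≡ suc m
        zd = cong pred ed
        πMlt : π M < suc m
        πMlt = ltSm (rg MN) (nev MN 0N π0 M≢0) (nev MN 1N π1 (λ ()))

    secondMaxSecond : π 1 ≡ suc m → Result
    secondMaxSecond π1 with sj {0} 0N
    ... | z , zN , πz with z ≟ M
    ...   | yes refl = Decreasing.decreasing π1 πz
    ...   | no z≢M = ⊥-elim (zeroEarly π1 z zN πz z≢M)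

    classifyMaxFirst : Result
    classifyMaxFirst with sj {suc m} smN
    ... | q' , q'N , πq' with q' ≟ 1 | q' ≟ M
    ...   | yes refl | _ = secondMaxSecond πq'
    ...   | no _ | yes refl = secondMaxLast πq'
    ...   | no q'≢1 | no q'≢M = secondMaxMiddle q' (suc m ∸ q') (m+[n∸m]≡n (≤-pred q'M)) 2q πq'
      where
        q'≢0 : q' ≢ 0
        q'≢0 e = <-irrefl (sym (trans (sym π0) (trans (cong π (sym e)) πq'))) (n<1+n _)
        q'M : q' < M
        q'M = ltM q'N q'≢M
        2q : 2 ≤ q'
        2q = ≤∧≢⇒< (≤∧≢⇒< z≤n (λ e → q'≢0 (sym e))) (λ e → q'≢1 (sym e))

  classifyTop : π M ≢ M → Result
  classifyTop ne with sj {M} MN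
  ... | q , qN , πq with q ≟ 0
  ...   | yes refl = MaxFirst.classifyMaxFirst πq
  ...   | no q≢0 = maxAt q (suc m ∸ q) (m+[n∸m]≡n (≤-pred qM)) (≤∧≢⇒< z≤n (λ e → q≢0 (sym e))) πq
    where
      qM : q < M
      qM = ltM qN (λ e → ne (subst (λ x → π x ≡ M) e πq))

restrict : ∀ {n π} → Good (suc n) π → π n ≡ n → Good n π
restrict {n} {π} (rg , ij , a1 , a2 , b1 , b2) πn =
  rg' , (λ p q e → ij (m<n⇒m<1+n p) (m<n⇒m<1+n q) e) ,
  (λ a b c → a1 a b (m<n⇒m<1+n c)) , (λ a b c d → a2 a b c (m<n⇒m<1+n d)) ,
  (λ a b c → b1 a b (m<n⇒m<1+n c)) , (λ a b c d → b2 a b c (m<n⇒m<1+n d))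
  where
    rg' : Rng n π
    rg' {i} i<n = ≤∧≢⇒< (≤-pred (rg (m<n⇒m<1+n i<n))) (λ e → <-irrefl (ij (m<n⇒m<1+n i<n) (n<1+n n) (trans e (sym πn))) i<n)

Classified : ℕ → (ℕ → ℕ) → Set
Classified n π = ∃ λ c → c ∈ codes n × (∀ {i} → i < n → π i ≡ den n c i)

classified-ext : ∀ {n π} → π n ≡ n → Classified n π → Classified (suc n) π
classified-ext {n} {π} πn (c , mem , eqs) = ext c , mem-ext {n} mem , eqs'
  where
    eqs' : ∀ {i} → i < suc n → π i ≡ den (suc n) (ext c) i
    eqs' {i} i<sn with m≤n⇒m<n∨m≡n (≤-pred i<sn)
    ... | inj₁ lt = trans (eqs lt) (sym (extend-< {n} {den n c} lt))
    ... | inj₂ refl = trans πn (sym (extend-last {n} {den n c}))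

<1⇒≡0 : ∀ {x} → x < 1 → x ≡ 0
<1⇒≡0 (s≤s z≤n) = refl

<2⇒≢1⇒≡0 : ∀ {x} → x < 2 → x ≢ 1 → x ≡ 0
<2⇒≢1⇒≡0 (s≤s z≤n) _ = refl
<2⇒≢1⇒≡0 (s≤s (s≤s z≤n)) ne = ⊥-elim (ne refl)

<2⇒≢0⇒≡1 : ∀ {x} → x < 2 → x ≢ 0 → x ≡ 1
<2⇒≢0⇒≡1 (s≤s z≤n) ne = ⊥-elim (ne refl)
<2⇒≢0⇒≡1 (s≤s (s≤s z≤n)) _ = refl

classification-complete : ∀ n π → 1 ≤ n → Good n π → Classified n π
classification-complete (suc zero) π _ G = dec , here refl , eq
  where
    eq : ∀ {i} → i < 1 → π i ≡ den 1 dec i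
    eq {zero} _ = <1⇒≡0 (proj₁ G {0} (s≤s z≤n))
    eq {suc i} (s≤s ())
classification-complete (suc (suc zero)) π _ G with π 1 ≟ 1
... | yes e = classified-ext e (classification-complete 1 π (s≤s z≤n) (restrict G e))
... | no ne = dec , there (here refl) , eq
  where
    rg : Rng 2 π
    rg = proj₁ G
    ij : Inj 2 π
    ij = proj₁ (proj₂ G)
    π1 : π 1 ≡ 0
    π1 = <2⇒≢1⇒≡0 (rg {1} (s≤s (s≤s z≤n))) ne
    z≢1 : 0 ≢ 1
    z≢1 ()
    π0 : π 0 ≡ 1
    π0 = <2⇒≢0⇒≡1 (rg {0} (s≤s z≤n)) (λ e → z≢1 (ij (s≤s z≤n) (s≤s (s≤s z≤n)) (trans e (sym π1))))
    eq : ∀ {i} → i < 2 → π i ≡ den 2 dec i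
    eq {zero} _ = π0
    eq {suc zero} _ = π1
    eq {suc (suc i)} (s≤s (s≤s ()))
classification-complete (suc (suc (suc m))) π _ G =
  lastFixedOrNot (π (suc (suc m)) ≟ suc (suc m)) (classification-complete (suc (suc m)) π (s≤s z≤n))
  where
    lastFixedOrNot : Dec (π (suc (suc m)) ≡ suc (suc m)) →
                     (Good (suc (suc m)) π → Classified (suc (suc m)) π) → Classified (suc (suc (suc m))) π
    lastFixedOrNot (yes e) IH = classified-ext e (IH (restrict G e))
    lastFixedOrNot (no ne) _ = let c , mem , eqs = Classify.classifyTop m π G ne in c , mem-E {suc (suc (suc m))} mem , eqs



-- Soundness: every code denotes a Good permutation.

inc⇒132 : ∀ {n f} → (∀ {i j} → i < j → j < n → f i < f j) → Av132 n f
inc⇒132 inc ij jl ln x y = <-asym y (inc jl ln)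

inc⇒3421 : ∀ {n f} → (∀ {i j} → i < j → j < n → f i < f j) → Av3421 n f
inc⇒3421 inc ij jk kl ln x y z = <-asym x (inc kl ln)

dec⇒132 : ∀ {n f} → (∀ {i j} → i < j → j < n → f j < f i) → Av132 n f
dec⇒132 dc ij jl ln x y = <-asym x (dc (<-trans ij jl) ln)

dec⇒3421 : ∀ {n f} → (∀ {i j} → i < j → j < n → f j < f i) → Av3421 n f
dec⇒3421 dc ij jk kl ln x y z = <-asym z (dc ij (<-trans jk (<-trans kl ln)))

idGood132 : ∀ {n} → Av132 n (λ i → i)
idGood132 = inc⇒132 (λ ij _ → ij)

idGood3421 : ∀ {n} → Av3421 n (λ i → i)
idGood3421 = inc⇒3421 (λ ij _ → ij)

injInv : ∀ {n f} (h : ℕ → ℕ) → (∀ {i} → i < n → h (f i) ≡ i) → Inj n f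
injInv h inv iN jN e = trans (sym (inv iN)) (trans (cong h e) (inv jN))

mkGood : ∀ {n f} (g : ℕ → ℕ) → Rng n f → Inj n f → Av132 n f → Av3421 n f → sq f ≈[ n ] g → Av132 n g → Av3421 n g → Good n f
mkGood g rg ij a1 a2 e b1 b2 = rg , ij , a1 , a2 , cong132 (λ p → sym (e p)) b1 , cong3421 (λ p → sym (e p)) b2

module Ext (n : ℕ) (f : ℕ → ℕ) where
  g : ℕ → ℕ
  g = extend n f
  gl : ∀ {i} → i < n → g i ≡ f i
  gl = extend-< {n} {f}
  gn : g n ≡ n
  gn = extend-last {n} {f}

  split : ∀ {i} → i < suc n → i < n ⊎ i ≡ n
  split iN = m≤n⇒m<n∨m≡n (≤-pred iN)

  rngE : Rng n f → Rng (suc n) g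
  rngE rg iN with split iN
  ... | inj₁ lt = m<n⇒m<1+n (subst (_< n) (sym (gl lt)) (rg lt))
  ... | inj₂ refl = subst (_< suc n) (sym gn) (n<1+n n)

  injE : Rng n f → Inj n f → Inj (suc n) g
  injE rg ij {i} {j} iN jN e with split iN | split jN
  ... | inj₁ a | inj₁ b = ij a b (trans (sym (gl a)) (trans e (gl b)))
  ... | inj₁ a | inj₂ refl = ⊥-elim (<-irrefl (trans (sym (gl a)) (trans e gn)) (rg a))
  ... | inj₂ refl | inj₁ b = ⊥-elim (<-irrefl (trans (sym (gl b)) (trans (sym e) gn)) (rg b))
  ... | inj₂ refl | inj₂ refl = refl

  a132E : Rng n f → Av132 n f → Av132 (suc n) g
  a132E rg av {i} {j} {l} ij jl ln x y with split ln
  ... | inj₁ lt = av ij jl lt (subst₂ _<_ (gl iN) (gl lt) x) (subst₂ _<_ (gl lt) (gl jN) y)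
    where jN = <-trans jl lt
          iN = <-trans ij jN
  ... | inj₂ refl = <-asym (subst₂ _<_ gn (gl jl) y) (rg jl)

  a3421E : Rng n f → Av3421 n f → Av3421 (suc n) g
  a3421E rg av {i} {j} {k} {l} ij jk kl ln x y z with split ln
  ... | inj₁ lt = av ij jk kl lt (subst₂ _<_ (gl lt) (gl kN) x) (subst₂ _<_ (gl kN) (gl iN) y) (subst₂ _<_ (gl iN) (gl jN) z)
    where kN = <-trans kl lt
          jN = <-trans jk kN
          iN = <-trans ij jN
  ... | inj₂ refl = <-asym (subst₂ _<_ gn (gl kl) x) (rg kl)

  sqE : Rng n f → sq g ≈[ suc n ] extend n (sq f)
  sqE rg {i} iN with split iN
  ... | inj₁ lt = trans (cong g (gl lt)) (trans (gl (rg lt)) (sym (extend-< {n} {sq f} lt)))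
  ... | inj₂ refl = trans (cong g gn) (trans gn (sym (extend-last {n} {sq f})))

Good-ext : ∀ n f → Good n f → Good (suc n) (extend n f)
Good-ext n f (rg , ij , a1 , a2 , b1 , b2) =
  mkGood (extend n (sq f)) (E1.rngE rg) (E1.injE rg ij) (E1.a132E rg a1) (E1.a3421E rg a2) (E1.sqE rg)
         (E2.a132E (λ p → rg (rg p)) b1) (E2.a3421E (λ p → rg (rg p)) b2)
  where
    module E1 = Ext n f
    module E2 = Ext n (sq f)

Good-dec : ∀ n → Good (suc n) (λ i → n ∸ i)
Good-dec n = mkGood (λ i → i) rg ij (dec⇒132 d) (dec⇒3421 d) sqe idGood132 idGood3421
  where
    rg : Rng (suc n) (λ i → n ∸ i)
    rg {i} _ = s≤s (m∸n≤m n i)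
    ij : Inj (suc n) (λ i → n ∸ i)
    ij iN jN e = ∸-cancelˡ-≡ (≤-pred iN) (≤-pred jN) e
    d : ∀ {i j} → i < j → j < suc n → n ∸ j < n ∸ i
    d ij jN = ∸-monoʳ-< ij (≤-pred jN)
    sqe : sq (λ i → n ∸ i) ≈[ suc n ] (λ i → i)
    sqe iN = m∸[m∸n]≡n (≤-pred iN)

-- A function made of two increasing runs, the second entirely below the first,
-- avoids 132 and 3421; rotations are of this form.
module TwoRuns {N : ℕ} {f : ℕ → ℕ} (b : ℕ)
  (r1 : ∀ {i j} → i < j → j < b → f i < f j)
  (r2 : ∀ {i j} → b ≤ i → i < j → j < N → f i < f j)
  (cr : ∀ {i l} → i < b → b ≤ l → l < N → f l < f i) where

  tr132 : Av132 N f
  tr132 {i} {j} {l} ij jl lN x y with j <? b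
  ... | no j≮b = <-asym y (r2 (≮⇒≥ j≮b) jl lN)
  ... | yes j<b with l <? b
  ...   | yes l<b = <-asym y (r1 jl l<b)
  ...   | no l≮b = <-asym x (cr (<-trans ij j<b) (≮⇒≥ l≮b) lN)

  tr3421 : Av3421 N f
  tr3421 {i} {j} {k} {l} ij jk kl lN x y z with k <? b
  ... | no k≮b = <-asym x (r2 (≮⇒≥ k≮b) kl lN)
  ... | yes k<b with l <? b
  ...   | yes l<b = <-asym x (r1 kl l<b)
  ...   | no l≮b = <-asym y (r1 (<-trans ij jk) k<b)

module Rot (n r : ℕ) (r<N : r < suc n) where
  N : ℕ
  N = suc n
  f : ℕ → ℕ
  f i = (i + r) % N
  b : ℕ
  b = N ∸ r
  bN : b + r ≡ N
  bN = m∸n+n≡m (<⇒≤ r<N)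
  lo : ∀ {i} → i < b → i + r < N
  lo {i} ib = subst (i + r <_) bN (+-monoˡ-< r ib)
  hiN : ∀ {i} → b ≤ i → N ≤ i + r
  hiN {i} bi = subst (_≤ i + r) bN (+-monoˡ-≤ r bi)
  f-lo : ∀ {i} → i < b → f i ≡ i + r
  f-lo ib = m≤n⇒m%n≡m (≤-pred (lo ib))
  f-hi : ∀ {i} → b ≤ i → i < N → f i ≡ i + r ∸ N
  f-hi {i} bi iN = trans (cong (_% N) (sym (m∸n+n≡m (hiN bi)))) (trans ([m+n]%n≡m%n (i + r ∸ N) N) (m≤n⇒m%n≡m (≤-pred tN)))
    where
      tN : i + r ∸ N < N
      tN = <-trans (subst (i + r ∸ N <_) (m+n∸m≡n N r) (∸-monoˡ-< (+-monoˡ-< r iN) (hiN bi))) r<N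
  r1 : ∀ {i j} → i < j → j < b → f i < f j
  r1 ij jb = subst₂ _<_ (sym (f-lo (<-trans ij jb))) (sym (f-lo jb)) (+-monoˡ-< r ij)
  r2 : ∀ {i j} → b ≤ i → i < j → j < N → f i < f j
  r2 bi ij jN = subst₂ _<_ (sym (f-hi bi (<-trans ij jN))) (sym (f-hi (≤-trans bi (<⇒≤ ij)) jN))
                   (∸-monoˡ-< (+-monoˡ-< r ij) (hiN bi))
  cr : ∀ {i l} → i < b → b ≤ l → l < N → f l < f i
  cr {i} {l} ib bl lN = subst₂ _<_ (sym (f-hi bl lN)) (sym (f-lo ib))
      (≤-trans (subst (l + r ∸ N <_) (m+n∸m≡n N r) (∸-monoˡ-< (+-monoˡ-< r lN) (hiN bl))) (m≤n+m r i))
  open TwoRuns {N} {f} b r1 r2 cr public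

modAdd : ∀ n a c → ((a % suc n) + c) % suc n ≡ (a + c) % suc n
modAdd n a c =
  trans (%-distribˡ-+ (a % suc n) c (suc n))
    (trans (cong (λ x → (x + c % suc n) % suc n) (m%n%n≡m%n a (suc n))) (sym (%-distribˡ-+ a c (suc n))))

-- Rotations are Good: a rotation is injective (the rotation by N − r undoes it),
-- and its square is the rotation by 2r.
Good-rot : ∀ n r → r < suc n → Good (suc n) (λ i → (i + r) % suc n)
Good-rot n r r<N = mkGood (λ i → (i + r') % suc n) (λ {i} _ → m%n<n (i + r) (suc n)) inj R.tr132 R.tr3421 sqe R'.tr132 R'.tr3421
  where
    module R = Rot n r r<N
    r' = (r + r) % suc n
    module R' = Rot n r' (m%n<n (r + r) (suc n))
    inj : Inj (suc n) (λ i → (i + r) % suc n)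
    inj = injInv (λ i → (i + (suc n ∸ r)) % suc n) inv
      where
        inv : ∀ {i} → i < suc n → ((i + r) % suc n + (suc n ∸ r)) % suc n ≡ i
        inv {i} iN = trans (modAdd n (i + r) (suc n ∸ r))
                     (trans (cong (_% suc n) (trans (+-assoc i r (suc n ∸ r)) (cong (i +_) (m+[n∸m]≡n (<⇒≤ r<N)))))
                       (trans ([m+n]%n≡m%n i (suc n)) (m≤n⇒m%n≡m (≤-pred iN))))
    sqe : sq (λ i → (i + r) % suc n) ≈[ suc n ] (λ i → (i + r') % suc n)
    sqe {i} _ = trans (modAdd n (i + r) r) (trans (cong (_% suc n) (+-assoc i r r)) (sym (trans (%-distribˡ-+ i r' (suc n))
                  (trans (cong (λ x → (i % suc n + x) % suc n) (m%n%n≡m%n (r + r) (suc n))) (sym (%-distribˡ-+ i (r + r) (suc n)))))))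

-- The three frame families: they avoid both patterns, G and Ha are mutually
-- inverse, Hb is an involution, and the squares of G and Ha are frames with
-- identity core.
module Frames (m : ℕ) where
  N M : ℕ
  N = suc (suc (suc m))
  M = suc (suc m)

  module Core (γ : ℕ → ℕ) (crg : ∀ {i} → 1 ≤ i → i ≤ m → 1 ≤ γ i × γ i ≤ m)
              (c132 : Av132I 1 (suc m) γ) (c231 : Av231I 1 (suc m) γ) where

    module Sh (a b c : ℕ) where
      F : ℕ → ℕ
      F = frame m a b c γ
      Fb : F (suc m) ≡ b
      Fb = frame-b {m} {a} {b} {c} {γ}
      Fc : F M ≡ c
      Fc = frame-c {m} {a} {b} {c} {γ}
      Fm : ∀ {i} → 1 ≤ i → i ≤ m → F i ≡ γ i
      Fm = frame-mid {m} {a} {b} {c} {γ}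
      Fle : ∀ {i} → 1 ≤ i → i ≤ m → F i ≤ m
      Fle 1i im = subst (_≤ m) (sym (Fm 1i im)) (proj₂ (crg 1i im))
      rngF : a < N → b < N → c < N → Rng N F
      rngF aN bN cN {i} iN with frame-position {m} iN
      ... | inj₁ refl = aN
      ... | inj₂ (inj₁ (1i , im)) = ≤-<-trans (Fle 1i im) (m<n+m m {3} (s≤s z≤n))
      ... | inj₂ (inj₂ (inj₁ refl)) = subst (_< N) (sym Fb) bN
      ... | inj₂ (inj₂ (inj₂ refl)) = subst (_< N) (sym Fc) cN
      core132 : ∀ {i j l} → 1 ≤ i → i < j → j < l → l ≤ m → F i < F l → F l < F j → ⊥
      core132 1i ij jl lm x y = c132 1i ij jl (s≤s lm)
         (subst₂ _<_ (Fm 1i (≤-trans (<⇒≤ (<-trans ij jl)) lm)) (Fm l1 lm) x)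
         (subst₂ _<_ (Fm l1 lm) (Fm j1 (≤-trans (<⇒≤ jl) lm)) y)
        where j1 = ≤-trans 1i (<⇒≤ ij)
              l1 = ≤-trans j1 (<⇒≤ jl)
      core231 : ∀ {i j l} → 1 ≤ i → i < j → j < l → l ≤ m → F l < F i → F i < F j → ⊥
      core231 1i ij jl lm x y = c231 1i ij jl (s≤s lm)
         (subst₂ _<_ (Fm l1 lm) (Fm 1i (≤-trans (<⇒≤ (<-trans ij jl)) lm)) x)
         (subst₂ _<_ (Fm 1i (≤-trans (<⇒≤ (<-trans ij jl)) lm)) (Fm j1 (≤-trans (<⇒≤ jl) lm)) y)
        where j1 = ≤-trans 1i (<⇒≤ ij)
              l1 = ≤-trans j1 (<⇒≤ jl)
      pos1 : ∀ {i j} → i < j → 1 ≤ j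
      pos1 ij = ≤-trans (s≤s z≤n) ij

    module SG where
      open Sh (suc m) M 0 public
      rg : Rng N F
      rg = rngF (<-trans (n<1+n _) (n<1+n _)) (n<1+n _) (s≤s z≤n)
      av132 : Av132 N F
      av132 {i} {j} {l} ij jl lN x y with frame-position {m} lN
      ... | inj₁ refl = ⊥-elim (<⇒≱ (<-trans ij jl) z≤n)
      ... | inj₂ (inj₂ (inj₂ refl)) = ⊥-elim (<⇒≱ (subst (F i <_) Fc x) z≤n)
      ... | inj₂ (inj₂ (inj₁ refl)) = <⇒≱ (subst (_< F j) Fb y) (≤-pred (rg (<-trans jl lN)))
      ... | inj₂ (inj₁ (1l , lm)) with i ≟ 0
      ...   | yes refl = <⇒≱ x (≤-trans (Fle 1l lm) (n≤1+n m))
      ...   | no i≢0 = core132 (≤∧≢⇒< z≤n (λ e → i≢0 (sym e))) ij jl lm x y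
      av3421 : Av3421 N F
      av3421 {i} {j} {k} {l} ij jk kl lN x y z with frame-position {m} lN
      ... | inj₁ refl = ⊥-elim (<⇒≱ (<-trans ij (<-trans jk kl)) z≤n)
      ... | inj₂ (inj₂ (inj₁ refl)) = <⇒≱ (subst (_< F k) Fb x) (≤-pred (rg (<-trans kl lN)))
      ... | inj₂ (inj₁ (1l , lm)) = side (≤-trans (<⇒≤ kl) lm)
        where
          side : k ≤ m → ⊥
          side km with i ≟ 0
          ... | yes refl = <⇒≱ z (≤-trans (Fle (pos1 ij) (≤-trans (<⇒≤ jk) km)) (n≤1+n m))
          ... | no i≢0 = core231 (≤∧≢⇒< z≤n (λ e → i≢0 (sym e))) ij jk km y z
      ... | inj₂ (inj₂ (inj₂ refl)) with frame-position {m} (<-trans kl lN)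
      ...   | inj₁ refl = ⊥-elim (<⇒≱ (<-trans ij jk) z≤n)
      ...   | inj₂ (inj₂ (inj₁ refl)) = <⇒≱ (subst (_< F i) Fb y) (≤-pred (rg (<-trans (<-trans ij jk) (<-trans kl lN))))
      ...   | inj₂ (inj₂ (inj₂ refl)) = <-irrefl refl kl
      ...   | inj₂ (inj₁ (1k , km)) with i ≟ 0
      ...     | yes refl = <⇒≱ z (≤-trans (Fle (pos1 ij) (≤-trans (<⇒≤ jk) km)) (n≤1+n m))
      ...     | no i≢0 = core231 (≤∧≢⇒< z≤n (λ e → i≢0 (sym e))) ij jk km y z

    module SHa where
      open Sh M 0 (suc m) public
      rg : Rng N F
      rg = rngF (n<1+n _) (s≤s z≤n) (<-trans (n<1+n _) (n<1+n _))
      lowv : ∀ {p} → 1 ≤ p → p ≤ suc m → F p ≤ suc m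
      lowv {p} 1p psm with m≤n⇒m<n∨m≡n psm
      ... | inj₂ refl = subst (_≤ suc m) (sym Fb) z≤n
      ... | inj₁ lt = ≤-trans (Fle 1p (≤-pred lt)) (n≤1+n m)
      i≢0 : ∀ {i j} → i < j → j < N → F i < F j → i ≢ 0
      i≢0 ij jN x refl = <⇒≱ x (≤-pred (rg jN))
      av132 : Av132 N F
      av132 {i} {j} {l} ij jl lN x y with frame-position {m} lN
      ... | inj₁ refl = ⊥-elim (<⇒≱ (<-trans ij jl) z≤n)
      ... | inj₂ (inj₂ (inj₁ refl)) = ⊥-elim (<⇒≱ (subst (F i <_) Fb x) z≤n)
      ... | inj₂ (inj₂ (inj₂ refl)) = <⇒≱ (subst (_< F j) Fc y) (lowv (pos1 ij) (≤-pred jl))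
      ... | inj₂ (inj₁ (1l , lm)) = core132 (≤∧≢⇒< z≤n (λ e → i≢0 (<-trans ij jl) lN x (sym e))) ij jl lm x y
      av3421 : Av3421 N F
      av3421 {i} {j} {k} {l} ij jk kl lN x y z with frame-position {m} lN
      ... | inj₁ refl = ⊥-elim (<⇒≱ (<-trans ij (<-trans jk kl)) z≤n)
      ... | inj₂ (inj₂ (inj₂ refl)) = <⇒≱ (subst (_< F k) Fc x) (lowv (pos1 (<-trans ij jk)) (≤-pred kl))
      ... | inj₂ (inj₂ (inj₁ refl)) = core231 1i ij jk (≤-pred kl) y z
        where 1i = ≤∧≢⇒< z≤n (λ e → i≢0 ij (<-trans jk (<-trans kl lN)) z (sym e))
      ... | inj₂ (inj₁ (1l , lm)) = core231 1i ij jk (≤-trans (<⇒≤ kl) lm) y z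
        where 1i = ≤∧≢⇒< z≤n (λ e → i≢0 ij (<-trans jk (<-trans kl lN)) z (sym e))

    module SHb where
      open Sh M (suc m) 0 public
      rg : Rng N F
      rg = rngF (n<1+n _) (<-trans (n<1+n _) (n<1+n _)) (s≤s z≤n)
      i≢0 : ∀ {i j} → i < j → j < N → F i < F j → i ≢ 0
      i≢0 ij jN x refl = <⇒≱ x (≤-pred (rg jN))
      av132 : Av132 N F
      av132 {i} {j} {l} ij jl lN x y with frame-position {m} lN
      ... | inj₁ refl = ⊥-elim (<⇒≱ (<-trans ij jl) z≤n)
      ... | inj₂ (inj₂ (inj₂ refl)) = ⊥-elim (<⇒≱ (subst (F i <_) Fc x) z≤n)
      ... | inj₂ (inj₂ (inj₁ refl)) = <⇒≱ (subst (_< F j) Fb y) (≤-trans (Fle (pos1 ij) (≤-pred jl)) (n≤1+n m))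
      ... | inj₂ (inj₁ (1l , lm)) = core132 (≤∧≢⇒< z≤n (λ e → i≢0 (<-trans ij jl) lN x (sym e))) ij jl lm x y
      av3421 : Av3421 N F
      av3421 {i} {j} {k} {l} ij jk kl lN x y z with frame-position {m} lN
      ... | inj₁ refl = ⊥-elim (<⇒≱ (<-trans ij (<-trans jk kl)) z≤n)
      ... | inj₂ (inj₂ (inj₁ refl)) = <⇒≱ (subst (_< F k) Fb x) (≤-trans (Fle (pos1 (<-trans ij jk)) (≤-pred kl)) (n≤1+n m))
      ... | inj₂ (inj₁ (1l , lm)) = core231 1i ij jk (≤-trans (<⇒≤ kl) lm) y z
        where 1i = ≤∧≢⇒< z≤n (λ e → i≢0 ij (<-trans jk (<-trans kl lN)) z (sym e))
      ... | inj₂ (inj₂ (inj₂ refl)) with frame-position {m} (<-trans kl lN)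
      ...   | inj₁ refl = ⊥-elim (<⇒≱ (<-trans ij jk) z≤n)
      ...   | inj₂ (inj₂ (inj₂ refl)) = <-irrefl refl kl
      ...   | inj₂ (inj₂ (inj₁ refl)) = <⇒≱ (subst (_< F i) Fb y) (≤-trans (Fle 1i (≤-pred (<-trans ij jk))) (n≤1+n m))
        where 1i = ≤∧≢⇒< z≤n (λ e → i≢0 ij (<-trans jk (<-trans kl lN)) z (sym e))
      ...   | inj₂ (inj₁ (1k , km)) = core231 1i ij jk km y z
        where 1i = ≤∧≢⇒< z≤n (λ e → i≢0 ij (<-trans jk (<-trans kl lN)) z (sym e))

  frame-id : (λ i → i) ≈[ N ] frame m 0 (suc m) M (λ i → i)
  frame-id = frame-ext (λ i → i) refl (λ _ _ → refl) refl refl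

  idRng : ∀ {i} → 1 ≤ i → i ≤ m → 1 ≤ i × i ≤ m
  idRng 1i im = 1i , im
  id132 : Av132I 1 (suc m) (λ i → i)
  id132 _ ik kl _ x y = <-asym y kl
  id231 : Av231I 1 (suc m) (λ i → i)
  id231 _ ik kl _ x y = <-asym x (<-trans ik kl)

  module OverRevPrefix (j : ℕ) (jm : j ≤ m) where
    open Core (revPrefix j) (revPrefix-range jm) revPrefix-132 revPrefix-231
    module IdC = Core (λ i → i) idRng id132 id231
    module G = SG
    module Ha = SHa
    module Hb = SHb
    module IG = IdC.SG
    module IHa = IdC.SHa

    revPrefix-rng : ∀ {i} → 1 ≤ i → i ≤ m → 1 ≤ revPrefix j i × revPrefix j i ≤ m
    revPrefix-rng = revPrefix-range jm

    coreTwice : ∀ {a b c a′ b′ c′ i} → 1 ≤ i → i ≤ m →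
                frame m a′ b′ c′ (revPrefix j) (frame m a b c (revPrefix j) i) ≡ i
    coreTwice {a} {b} {c} {a′} {b′} {c′} 1i im =
      trans (cong (frame m a′ b′ c′ (revPrefix j)) (frame-mid {m} {a} {b} {c} {revPrefix j} 1i im))
        (trans (frame-mid {m} {a′} {b′} {c′} {revPrefix j} (proj₁ (revPrefix-rng 1i im)) (proj₂ (revPrefix-rng 1i im))) (revPrefix-invol 1i))

    invG : ∀ {i} → i < N → Ha.F (G.F i) ≡ i
    invG iN = trans (frame-ext (Ha.F ∘ G.F) Ha.Fb coreTwice (trans (cong Ha.F G.Fb) Ha.Fc) (cong Ha.F G.Fc) iN)
                    (sym (frame-id iN))
    invHa : ∀ {i} → i < N → G.F (Ha.F i) ≡ i
    invHa iN = trans (frame-ext (G.F ∘ Ha.F) G.Fc coreTwice (cong G.F Ha.Fb) (trans (cong G.F Ha.Fc) G.Fb) iN)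
                     (sym (frame-id iN))
    invHb : ∀ {i} → i < N → Hb.F (Hb.F i) ≡ i
    invHb iN = trans (frame-ext (Hb.F ∘ Hb.F) Hb.Fc coreTwice (trans (cong Hb.F Hb.Fb) Hb.Fb) (cong Hb.F Hb.Fc) iN)
                     (sym (frame-id iN))

    sqG : sq G.F ≈[ N ] IHa.F
    sqG = frame-ext (sq G.F) G.Fb coreTwice (trans (cong G.F G.Fb) G.Fc) (cong G.F G.Fc)
    sqHa : sq Ha.F ≈[ N ] IG.F
    sqHa = frame-ext (sq Ha.F) Ha.Fc coreTwice (cong Ha.F Ha.Fb) (trans (cong Ha.F Ha.Fc) Ha.Fb)

    goodG : Good N G.F
    goodG = mkGood IHa.F G.rg (injInv Ha.F invG) G.av132 G.av3421 sqG IHa.av132 IHa.av3421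
    goodHa : Good N Ha.F
    goodHa = mkGood IG.F Ha.rg (injInv G.F invHa) Ha.av132 Ha.av3421 sqHa IG.av132 IG.av3421
    goodHb : Good N Hb.F
    goodHb = mkGood (λ i → i) Hb.rg (injInv Hb.F invHb) Hb.av132 Hb.av3421 invHb idGood132 idGood3421

E-good : ∀ n c → c ∈ E n → Good n (den n c)
E-good (suc zero) c (here refl) = Good-dec 0
E-good (suc (suc zero)) c (here refl) = Good-dec 1
E-good (suc (suc (suc m))) c p with ∈-++⁻ (map rot (range 1 (suc (suc m)))) p
... | inj₁ q with ∈-map⁻ rot q
...   | s , sm , refl = Good-rot (suc (suc m)) s (proj₂ (∈-range⁻ sm))
E-good (suc (suc (suc m))) c p | inj₂ (here refl) = Good-dec (suc (suc m))
E-good (suc (suc (suc m))) c p | inj₂ (there q) with ∈-++⁻ (map fg (range 1 m)) q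
... | inj₁ q' with ∈-map⁻ fg q'
...   | j , jm , refl = Frames.OverRevPrefix.goodG m j (≤-pred (proj₂ (∈-range⁻ jm)))
E-good (suc (suc (suc m))) c p | inj₂ (there q) | inj₂ q' with ∈-++⁻ (map fha (range 1 m)) q'
... | inj₁ q'' with ∈-map⁻ fha q''
...   | j , jm , refl = Frames.OverRevPrefix.goodHa m j (≤-pred (proj₂ (∈-range⁻ jm)))
E-good (suc (suc (suc m))) c p | inj₂ (there q) | inj₂ q' | inj₂ q'' with ∈-map⁻ fhb q''
...   | j , jm , refl = Frames.OverRevPrefix.goodHb m j (≤-pred (proj₂ (∈-range⁻ jm)))

codes-good : ∀ n c → c ∈ codes n → Good n (den n c)
codes-good (suc n) c p with ∈-++⁻ (map ext (codes n)) p
... | inj₂ q = E-good (suc n) c q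
... | inj₁ q with ∈-map⁻ ext q
...   | c' , m' , refl = Good-ext n (den n c') (codes-good n c' m')

allGood : ∀ n → All (λ c → Good n (den n c)) (codes n)
allGood n = All.tabulate (λ {c} → codes-good n c)



-- Distinctness: different codes of the same size denote different permutations.

Differ : ℕ → Code → Code → Set
Differ n c c' = ∃ λ i → i < n × den n c i ≢ den n c' i

cross : ∀ {A : Set} {R : A → A → Set} {xs ys} → (∀ {x y} → x ∈ xs → y ∈ ys → R x y) → All (λ x → All (R x) ys) xs
cross f = All.tabulate (λ mx → All.tabulate (λ my → f mx my))

apRngB : ∀ {R : Code → Code → Set} (f : ℕ → Code) a k →
         (∀ {x y} → a ≤ x → x < y → y < a + k → R (f x) (f y)) → AllPairs R (map f (range a k))
apRngB f a zero h = []
apRngB {R} f a (suc k) h =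
  AllP.map⁺ (All.tabulate (λ {y} my → h ≤-refl (proj₁ (∈-range⁻ my)) (subst (y <_) (sym (+-suc a k)) (proj₂ (∈-range⁻ my)))))
  ∷ apRngB f (suc a) k h'
  where
    h' : ∀ {x y} → suc a ≤ x → x < y → y < suc a + k → R (f x) (f y)
    h' {x} {y} ax xy yk = h (<⇒≤ ax) xy (subst (y <_) (sym (+-suc a k)) yk)

-- The primitive codes are pairwise different, witnessed at positions 0, 1 or m+2,
-- and none of them fixes its last entry.
module DistinctE (m : ℕ) where
  N M : ℕ
  N = suc (suc (suc m))
  M = suc (suc m)
  d : Code → ℕ → ℕ
  d = den N

  rot0 : ∀ {s} → s < N → d (rot s) 0 ≡ s
  rot0 sN = m≤n⇒m%n≡m (≤-pred sN)
  rotM : ∀ {s} → 1 ≤ s → s < N → d (rot s) M ≡ s ∸ 1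
  rotM {suc s'} _ sN = trans (cong (_% N) (lem m s')) (rot-hi (suc (suc m)) s' (<-trans (n<1+n s') sN))
    where lem : ∀ m s' → suc (suc m) + suc s' ≡ s' + suc (suc (suc m))
          lem = solve-∀
  rot1M : d (rot M) 1 ≡ 0
  rot1M = rot-hi (suc (suc m)) 0 (s≤s z≤n)
  decM : d dec M ≡ 0
  decM = n∸n≡0 M
  fr1 : ∀ {a b c j} → 1 ≤ j → 1 ≤ m → frame m a b c (revPrefix j) 1 ≡ j
  fr1 {a} {b} {c} {j} 1j 1m = trans (frame-mid {m} {a} {b} {c} {revPrefix j} ≤-refl 1m) (revPrefix-≤ 1j)
  frM : ∀ {a b c j} → frame m a b c (revPrefix j) M ≡ c
  frM {a} {b} {c} {j} = frame-c {m} {a} {b} {c} {revPrefix j}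

  at : ∀ c c' i → i < N → d c i ≢ d c' i → Differ N c c'
  at c c' i iN ne = i , iN , ne

  0N : 0 < N
  0N = s≤s z≤n
  1N : 1 < N
  1N = s≤s (s≤s z≤n)
  MN : M < N
  MN = n<1+n M

  inJ : ∀ {x} → x ∈ range 1 m → 1 ≤ x × x ≤ m
  inJ p = proj₁ (∈-range⁻ p) , ≤-pred (proj₂ (∈-range⁻ p))

  s∸1≡0⇒s≡1 : ∀ {s} → 1 ≤ s → s ∸ 1 ≡ 0 → s ≡ 1
  s∸1≡0⇒s≡1 {suc zero} _ _ = refl
  s∸1≡0⇒s≡1 {suc (suc s)} _ ()
  dsm : 1 ≤ m → suc m ≢ 1
  dsm 1m e = <-irrefl (cong pred (sym e)) 1m
  z≢s : ∀ {a} → 0 ≢ suc a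
  z≢s ()
  s≢z : ∀ {a} → suc a ≢ 0
  s≢z ()
  s≢s1 : 1 ≢ M
  s≢s1 ()

  apR : AllPairs (Differ N) (map rot (range 1 M))
  apR = apRngB rot 1 M (λ {x} {y} 1x xy yN → at (rot x) (rot y) 0 0N (λ e → <⇒≢ xy (trans (sym (rot0 (<-trans xy yN))) (trans e (rot0 yN)))))

  apFr : ∀ (f : ℕ → Code) → (∀ {j} → 1 ≤ j → j ≤ m → d (f j) 1 ≡ j) → AllPairs (Differ N) (map f (range 1 m))
  apFr f v = apRngB f 1 m (λ {x} {y} 1x xy ym → at (f x) (f y) 1 1N (λ e → <⇒≢ xy
               (trans (sym (v 1x (≤-pred (<-trans xy ym)))) (trans e (v (≤-trans 1x (<⇒≤ xy)) (≤-pred ym))))))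

  fg1 : ∀ {j} → 1 ≤ j → j ≤ m → d (fg j) 1 ≡ j
  fg1 {j} 1j jm = fr1 {suc m} {M} {0} {j} 1j (≤-trans 1j jm)
  fha1 : ∀ {j} → 1 ≤ j → j ≤ m → d (fha j) 1 ≡ j
  fha1 {j} 1j jm = fr1 {M} {0} {suc m} {j} 1j (≤-trans 1j jm)
  fhb1 : ∀ {j} → 1 ≤ j → j ≤ m → d (fhb j) 1 ≡ j
  fhb1 {j} 1j jm = fr1 {M} {suc m} {0} {j} 1j (≤-trans 1j jm)

  R-D : ∀ {s} → 1 ≤ s → s < N → Differ N (rot s) dec
  R-D {s} 1s sN with s ≟ M
  ... | yes refl = at (rot s) dec 1 1N (λ e → z≢s (trans (sym rot1M) e))
  ... | no ne = at (rot s) dec 0 0N (λ e → ne (trans (sym (rot0 sN)) e))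

  R-G : ∀ {s j} → 1 ≤ s → s < N → 1 ≤ j → j ≤ m → Differ N (rot s) (fg j)
  R-G {s} {j} 1s sN 1j jm with s ≟ 1
  ... | yes refl = at (rot s) (fg j) 0 0N (λ e → dsm (≤-trans 1j jm) (sym (trans (sym (rot0 sN)) e)))
  ... | no ne = at (rot s) (fg j) M MN (λ e → ne (s∸1≡0⇒s≡1 1s (trans (sym (rotM 1s sN)) (trans e (frM {suc m} {M} {0} {j})))))

  R-Ha : ∀ {s j} → 1 ≤ s → s < N → 1 ≤ j → j ≤ m → Differ N (rot s) (fha j)
  R-Ha {s} {j} 1s sN 1j jm with s ≟ M
  ... | yes refl = at (rot s) (fha j) 1 1N (λ e → <⇒≢ 1j (trans (sym rot1M) (trans e (fha1 1j jm))))
  ... | no ne = at (rot s) (fha j) 0 0N (λ e → ne (trans (sym (rot0 sN)) e))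

  R-Hb : ∀ {s j} → 1 ≤ s → s < N → 1 ≤ j → j ≤ m → Differ N (rot s) (fhb j)
  R-Hb {s} {j} 1s sN 1j jm with s ≟ 1
  ... | yes refl = at (rot s) (fhb j) 0 0N (λ e → s≢s1 (trans (sym (rot0 sN)) e))
  ... | no ne = at (rot s) (fhb j) M MN (λ e → ne (s∸1≡0⇒s≡1 1s (trans (sym (rotM 1s sN)) (trans e (frM {M} {suc m} {0} {j})))))

  D-G : ∀ {j} → Differ N dec (fg j)
  D-G {j} = at dec (fg j) 0 0N (λ ())
  D-Ha : ∀ {j} → Differ N dec (fha j)
  D-Ha {j} = at dec (fha j) M MN (λ e → z≢s (trans (sym decM) (trans e (frM {M} {0} {suc m} {j}))))
  D-Hb : ∀ {j} → 1 ≤ j → j ≤ m → Differ N dec (fhb j)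
  D-Hb {j} 1j jm = at dec (fhb j) 1 1N (λ e → <-irrefl (sym (trans e (fhb1 1j jm))) (s≤s jm))
  G-Ha : ∀ {j j'} → Differ N (fg j) (fha j')
  G-Ha {j} {j'} = at (fg j) (fha j') 0 0N (λ ())
  G-Hb : ∀ {j j'} → Differ N (fg j) (fhb j')
  G-Hb {j} {j'} = at (fg j) (fhb j') 0 0N (λ ())
  Ha-Hb : ∀ {j j'} → Differ N (fha j) (fhb j')
  Ha-Hb {j} {j'} = at (fha j) (fhb j') M MN (λ e → s≢z (trans (sym (frM {M} {0} {suc m} {j})) (trans e (frM {M} {suc m} {0} {j'}))))

  decR : ∀ {x} → x ∈ map rot (range 1 M) → ∃ λ s → (1 ≤ s × s < N) × x ≡ rot s
  decR p with ∈-map⁻ rot p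
  ... | s , sm , e = s , ∈-range⁻ sm , e
  decJ : ∀ (f : ℕ → Code) {x} → x ∈ map f (range 1 m) → ∃ λ j → (1 ≤ j × j ≤ m) × x ≡ f j
  decJ f p with ∈-map⁻ f p
  ... | j , jm , e = j , inJ jm , e

  Rest : List Code
  Rest = map fg (range 1 m) ++ (map fha (range 1 m) ++ map fhb (range 1 m))

  decodeRest : ∀ {y} → y ∈ Rest → ∃ λ j → (1 ≤ j × j ≤ m) × (y ≡ fg j ⊎ (y ≡ fha j ⊎ y ≡ fhb j))
  decodeRest p with ∈-++⁻ (map fg (range 1 m)) p
  ... | inj₁ q with decJ fg q
  ...   | j , r , e = j , r , inj₁ e
  decodeRest p | inj₂ q with ∈-++⁻ (map fha (range 1 m)) q
  ... | inj₁ q' with decJ fha q'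
  ...   | j , r , e = j , r , inj₂ (inj₁ e)
  decodeRest p | inj₂ q | inj₂ q' with decJ fhb q'
  ...   | j , r , e = j , r , inj₂ (inj₂ e)

  crossR : All (λ x → All (Differ N x) (dec ∷ Rest)) (map rot (range 1 M))
  crossR = cross f
    where
      f : ∀ {x y} → x ∈ map rot (range 1 M) → y ∈ dec ∷ Rest → Differ N x y
      f px py with decR px
      f px (here refl) | s , (1s , sN) , refl = R-D 1s sN
      f px (there py) | s , (1s , sN) , refl with decodeRest py
      ... | j , (1j , jm) , inj₁ refl = R-G 1s sN 1j jm
      ... | j , (1j , jm) , inj₂ (inj₁ refl) = R-Ha 1s sN 1j jm
      ... | j , (1j , jm) , inj₂ (inj₂ refl) = R-Hb 1s sN 1j jm

  crossD : All (Differ N dec) Rest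
  crossD = All.tabulate f
    where
      f : ∀ {y} → y ∈ Rest → Differ N dec y
      f py with decodeRest py
      ... | j , (1j , jm) , inj₁ refl = D-G
      ... | j , (1j , jm) , inj₂ (inj₁ refl) = D-Ha
      ... | j , (1j , jm) , inj₂ (inj₂ refl) = D-Hb 1j jm

  apE : AllPairs (Differ N) (E N)
  apE = APP.++⁺ apR (crossD ∷ apRest) crossR
    where
      apRest : AllPairs (Differ N) Rest
      apRest = APP.++⁺ (apFr fg fg1) (APP.++⁺ (apFr fha fha1) (apFr fhb fhb1) (cross (λ px py → hh px py)))
                 (cross (λ px py → gg px py))
        where
          hh : ∀ {x y} → x ∈ map fha (range 1 m) → y ∈ map fhb (range 1 m) → Differ N x y
          hh px py with decJ fha px | decJ fhb py
          ... | j , _ , refl | j' , _ , refl = Ha-Hb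
          gg : ∀ {x y} → x ∈ map fg (range 1 m) → y ∈ map fha (range 1 m) ++ map fhb (range 1 m) → Differ N x y
          gg px py with decJ fg px | ∈-++⁻ (map fha (range 1 m)) py
          ... | j , _ , refl | inj₁ q with decJ fha q
          ...   | j' , _ , refl = G-Ha
          gg px py | j , _ , refl | inj₂ q with decJ fhb q
          ...   | j' , _ , refl = G-Hb

  extM : ∀ {y} → y ∈ E N → d y M ≢ M
  extM p e with ∈-++⁻ (map rot (range 1 M)) p
  ... | inj₁ q with decR q
  ...   | s , (1s , sN) , refl = <-irrefl (trans (sym (rotM 1s sN)) e) (lt 1s sN)
    where lt : ∀ {s} → 1 ≤ s → s < N → s ∸ 1 < M
          lt {suc s} _ sN = ≤-pred sN
  extM p e | inj₂ (here refl) = z≢s (trans (sym decM) e)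
  extM p e | inj₂ (there q) with decodeRest q
  ... | j , _ , inj₁ refl = z≢s (trans (sym (frM {suc m} {M} {0} {j})) e)
  ... | j , _ , inj₂ (inj₁ refl) = <-irrefl (trans (sym (frM {M} {0} {suc m} {j})) e) (n<1+n _)
  ... | j , _ , inj₂ (inj₂ refl) = z≢s (trans (sym (frM {M} {suc m} {0} {j})) e)

Differ-ext : ∀ {n c c'} → Differ n c c' → Differ (suc n) (ext c) (ext c')
Differ-ext {n} {c} {c'} (i , iN , ne) =
  i , m<n⇒m<1+n iN , λ e → ne (trans (sym (extend-< {n} {den n c} iN)) (trans e (extend-< {n} {den n c'} iN)))

E-distinct : ∀ n → AllPairs (Differ n) (E n)
E-distinct zero = []
E-distinct (suc zero) = [] ∷ []
E-distinct (suc (suc zero)) = [] ∷ []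
E-distinct (suc (suc (suc m))) = DistinctE.apE m

-- An extension fixes the last position, a primitive code does not.
ext-vs-E : ∀ n → All (λ x → All (Differ (suc n) x) (E (suc n))) (map ext (codes n))
ext-vs-E zero = []
ext-vs-E (suc zero) = cross f
  where
    o≢z : 1 ≢ 0
    o≢z ()
    f : ∀ {x y} → x ∈ map ext (codes 1) → y ∈ E 2 → Differ 2 x y
    f px (here refl) with ∈-map⁻ ext px
    ... | c , _ , refl = 1 , s≤s (s≤s z≤n) , λ e → o≢z (trans (sym (extend-last {1} {den 1 c})) e)
ext-vs-E (suc (suc m)) = cross f
  where
    f : ∀ {x y} → x ∈ map ext (codes (suc (suc m))) → y ∈ E (suc (suc (suc m))) → Differ (suc (suc (suc m))) x y
    f px py with ∈-map⁻ ext px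
    ... | c , _ , refl = suc (suc m) , n<1+n _ , λ e → DistinctE.extM m py (sym (trans (sym (extend-last {suc (suc m)} {den (suc (suc m)) c})) e))

codes-distinct : ∀ n → AllPairs (Differ n) (codes n)
codes-distinct zero = []
codes-distinct (suc n) = APP.++⁺ (APP.map⁺ (AP.map Differ-ext (codes-distinct n))) (E-distinct (suc n)) (ext-vs-E n)



-- Counting.

AllPairs-withAll : ∀ {A : Set} {P : A → Set} {R : A → A → Set} {xs} → All P xs → AllPairs R xs →
                   AllPairs (λ x y → P x × P y × R x y) xs
AllPairs-withAll [] [] = []
AllPairs-withAll (px ∷ pxs) (rx ∷ rxs) =
  All.zipWith (λ { (py , r) → px , py , r }) (pxs , rx) ∷ AllPairs-withAll pxs rxs

hasCard-image : {A B : Set} (F : A → B) {P : B → Set} (xs : List A) →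
                AllPairs (λ a a′ → F a ≢ F a′) xs →
                (∀ {a} → a ∈ xs → P (F a)) →
                (∀ b → P b → ∃ λ a → a ∈ xs × F a ≡ b) →
                HasCard P (length xs)
hasCard-image F {P} xs distinct hits covers =
  map F xs , APP.map⁺ distinct , (λ b → mk⇔ (to b) (from b)) , length-map F xs
  where
    to : ∀ b → b ∈ map F xs → P b
    to b b∈ with ∈-map⁻ F b∈
    ... | a , a∈ , refl = hits a∈
    from : ∀ b → P b → b ∈ map F xs
    from b pb with covers b pb
    ... | a , a∈ , refl = ∈-map⁺ F a∈

count-132-3421 : ∀ n → 2 ≤ n → HasCard (InSAv {n = n} p132 p3421) (length (codes n))
count-132-3421 n 2≤n = hasCard-image F (codes n) distinct hits covers
  where
    F : Code → Word n
    F c = asWord n (den n c)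
    distinct : AllPairs (λ c c′ → F c ≢ F c′) (codes n)
    distinct = AP.map (λ {c} {c′} → apart {c} {c′}) (AllPairs-withAll (allGood n) (codes-distinct n))
      where
        apart : ∀ {c c′} → Good n (den n c) × Good n (den n c′) × Differ n c c′ → F c ≢ F c′
        apart (g , g′ , (i , iN , ne)) e = ne (asWord-injective (proj₁ g) (proj₁ g′) e iN)
    hits : ∀ {c} → c ∈ codes n → InSAv p132 p3421 (F c)
    hits {c} c∈ = asWord-Good (codes-good n c c∈)
    covers : ∀ w → InSAv p132 p3421 w → ∃ λ c → c ∈ codes n × F c ≡ w
    covers w s with classification-complete n (asFun w) (≤-trans (s≤s z≤n) 2≤n) (SAv132⇒Good w s)
    ... | c , c∈ , eqs = c , c∈ , trans (sym (asWord-cong eqs)) (asWord-asFun w)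

count-213-4312 : ∀ n → 2 ≤ n → HasCard (InSAv {n = n} p213 p4312) (length (codes n))
count-213-4312 (suc K) 2≤n = hasCard-image F (codes N) distinct hits covers
  where
    N : ℕ
    N = suc K
    open RevComp K hiding (N)
    F : Code → Word N
    F c = asWord N (rc (den N c))
    distinct : AllPairs (λ c c′ → F c ≢ F c′) (codes N)
    distinct = AP.map (λ {c} {c′} → apart {c} {c′}) (AllPairs-withAll (allGood N) (codes-distinct N))
      where
        apart : ∀ {c c′} → Good N (den N c) × Good N (den N c′) × Differ N c c′ → F c ≢ F c′
        apart {c} {c′} (g , g′ , (i , iN , ne)) e =
          ne (rc-injective (proj₁ g) (proj₁ g′) (asWord-injective (rcRng (den N c)) (rcRng (den N c′)) e) iN)
    hits : ∀ {c} → c ∈ codes N → InSAv p213 p4312 (F c)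
    hits {c} c∈ = asWord-Good′ (Good⇒Good′ (codes-good N c c∈))
    covers : ∀ w → InSAv p213 p4312 w → ∃ λ c → c ∈ codes N × F c ≡ w
    covers w s with classification-complete N (rc (asFun w)) (s≤s z≤n) (Good′⇒Good (SAv213⇒Good′ w s))
    ... | c , c∈ , eqs = c , c∈ , trans (sym (asWord-cong eqs′)) (asWord-asFun w)
      where
        eqs′ : asFun w ≈[ N ] rc (den N c)
        eqs′ q = trans (sym (rcInv (asFun-range w) q)) (rcCong eqs q)

theorem1p3 : (n : ℕ) → 2 ≤ n →
    HasCard (InSAv {n = n} p132 p3421) ((2 * n * n + 8) ∸ 7 * n) ×
    HasCard (InSAv {n = n} p213 p4312) ((2 * n * n + 8) ∸ 7 * n)
theorem1p3 n 2≤n =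
  subst (HasCard _) (length-codes n 2≤n) (count-132-3421 n 2≤n) ,
  subst (HasCard _) (length-codes n 2≤n) (count-213-4312 n 2≤n)
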